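{- Let $\pi\in\mathfrak S_n$ avoid the generalized pattern $[132$. Then $\pi$ is $\{123,312\}$-sortable if and only if the partial permutation $\alpha(\pi)$ avoids both $31|2$ and $\bar21\bar3$.
   Context: A partial permutation of $n$ is an injection $a:\{1,\dots,k\}\to\{1,\dots,n\}$ for some $0\le k\le n$, identified with the word $a_1\cdots a_k$ of its images. For $\pi\in\mathfrak S_n$ avoiding $[132$ (i.e. there are no $1<i<j$ with $\pi_1<\pi_j<\pi_i$), $\alpha(\pi)$ is the partial permutation of $n-1$ defined by $\alpha(\pi)_{\pi_i}=i-1$ for every $i$ with $\pi_i<\pi_1$ (its length is $\pi_1-1$). For a partial permutation $a=a_1\cdots a_m$ and $i<j<k$: $a_ia_ja_k$ is an occurrence of $31|2$ if $a_j<a_k<a_i$ and some integer of the interval $[a_j,a_k]$ is not among the entries of $a$; $a_ia_ja_k$ is an occurrence of $\bar21\bar3$ if $a_j<a_i<a_k$ and $a_i=a_k-1$. For a set $T$ of patterns, a $T$-stack is a stack whose content, read top to bottom, must never contain a subsequence order-isomorphic to a pattern of $T$; an input is processed greedily: push the next input element if this creates no forbidden occurrence, otherwise pop the top element to the output. The $T$-machine is the $T$-stack followed by a $\{21\}$-stack (classical stack, greedy); $\pi$ is $T$-sortable if the output of the $T$-machine on $\pi$ is the increasing permutation. -}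

module Defs where

open import Data.Nat using (ℕ; zero; suc; _∸_; _<_; _≤_; _<ᵇ_; _≡ᵇ_)
open import Data.Bool using (Bool; true; false; _∧_; _∨_; not; if_then_else_)
open import Data.List using (List; []; _∷_; _++_; map; length; upTo; zip)
open import Data.Bool.ListAction using (all; any)
open import Data.Product using (_×_; _,_)
open import Data.Empty using (⊥)
open import Relation.Nullary using (¬_)
open import Relation.Binary.PropositionalEquality using (_≡_)
open import Data.List.Relation.Binary.Permutation.Propositional using (_↭_)
open import Data.List.Relation.Binary.Sublist.Propositional using (_⊆_)
open import Data.List.Membership.Propositional using (_∈_)

range : ℕ → List ℕ
range n = map suc (upTo n)

IsPerm : ℕ → List ℕ → Set
IsPerm n π = π ↭ range n

Avoids[132 : List ℕ → Set
Avoids[132 [] = Data.Unit.⊤ where import Data.Unit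
Avoids[132 (x ∷ rest) =
  ∀ a b → (a ∷ b ∷ []) ⊆ rest → ¬ (x < b × b < a)

-- α(π): partial permutation with α(π)_{π_i} = i - 1 for π_i < π_1

-- 1-based position of v in a word (0 if absent)
pos : ℕ → List ℕ → ℕ
pos v [] = 0
pos v (y ∷ ys) = if v ≡ᵇ y then 1 else suc (pos v ys)

α : List ℕ → List ℕ
α [] = []
α π@(x ∷ _) = map (λ v → pos v π ∸ 1) (range (x ∸ 1))

Avoids31|2 : List ℕ → Set
Avoids31|2 a = ∀ x y z → (x ∷ y ∷ z ∷ []) ⊆ a → y < z → z < x →
  ¬ (Data.Product.∃ λ m → y ≤ m × m ≤ z × ¬ (m ∈ a))
  where import Data.Product

Avoids-b21b3 : List ℕ → Set
Avoids-b21b3 a = ∀ x y z → (x ∷ y ∷ z ∷ []) ⊆ a → y < x → x < z →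
  ¬ (x ≡ z ∸ 1)

subseqs : ℕ → List ℕ → List (List ℕ)
subseqs zero w = [] ∷ []
subseqs (suc k) [] = []
subseqs (suc k) (x ∷ w) = map (x ∷_) (subseqs k w) ++ subseqs (suc k) w

_⇔ᵇ_ : Bool → Bool → Bool
true ⇔ᵇ b = b
false ⇔ᵇ b = not b

-- order-isomorphism of two equal-length words (with distinct entries)
orderIso : List ℕ → List ℕ → Bool
orderIso [] [] = true
orderIso (p ∷ ps) (u ∷ us) =
  all (λ { (q , v) → (p <ᵇ q) ⇔ᵇ (u <ᵇ v) }) (zip ps us) ∧ orderIso ps us
orderIso _ _ = false

contains : List ℕ → List ℕ → Bool
contains w p = any (orderIso p) (subseqs (length p) w)

containsSome : List (List ℕ) → List ℕ → Bool
containsSome T w = any (contains w) T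

-- T-stack (greedy).  Stack as a list, head = top; read top to bottom.

pushGreedy : List (List ℕ) → ℕ → List ℕ → List ℕ → List ℕ × List ℕ
pushGreedy T x [] out = (x ∷ [] , out)   -- (a single element never forms a pattern of length ≥ 2)
pushGreedy T x (t ∷ s) out =
  if containsSome T (x ∷ t ∷ s)
  then pushGreedy T x s (out ++ t ∷ [])
  else (x ∷ t ∷ s , out)

runStack : List (List ℕ) → List ℕ → List ℕ → List ℕ → List ℕ
runStack T [] s out = out ++ s
runStack T (x ∷ xs) s out with pushGreedy T x s out
... | (s' , out') = runStack T xs s' out'

TStack : List (List ℕ) → List ℕ → List ℕ
TStack T w = runStack T w [] []

TMachine : List (List ℕ) → List ℕ → List ℕ
TMachine T w = TStack ((2 ∷ 1 ∷ []) ∷ []) (TStack T w)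

T123-312 : List (List ℕ)
T123-312 = (1 ∷ 2 ∷ 3 ∷ []) ∷ (3 ∷ 1 ∷ 2 ∷ []) ∷ []

Sortable : List (List ℕ) → ℕ → List ℕ → Set
Sortable T n π = TMachine T π ≡ range n

-- Write π = k ρ. The {123,312}-stack keeps k at its bottom, the entries smaller than k above the
-- others, and each of the two layers decreasing from the top: a small entry x pops exactly the
-- entries between x and k, a big one (larger than every earlier entry, by [132-avoidance) pops all
-- small entries. So the big entries leave last in decreasing order, and two small entries a before v
-- in ρ leave in reversed order exactly when a < v and every entry between them lies strictly between
-- a and k. By Knuth, the classical stack sorts this output iff it avoids 231, and an occurrence of
-- 231 in it amounts to a configuration in ρ that α(π), which records the positions in ρ of the values
-- below k, turns into an occurrence of 31|2 or of \bar21\bar3.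

module Submission where

open import Defs
open import Data.Nat using (ℕ; zero; suc; _<_; _≤_; _∸_; _<ᵇ_; _≡ᵇ_; _+_; z≤n; s≤s; z<s)
open import Data.Nat.Properties
open import Data.Bool using (true; false; T)
open import Data.Unit using (tt)
open import Data.Bool.Properties using (T-∧; T-≡)
open import Data.Product using (_×_; _,_; proj₁; proj₂; ∃; ∃₂)
open import Data.Sum using (_⊎_; inj₁; inj₂; [_,_]′)
open import Data.Empty using (⊥; ⊥-elim)
open import Relation.Nullary using (¬_; yes; no)
open import Relation.Nullary.Reflects using (ofʸ; ofⁿ)
open import Relation.Binary.PropositionalEquality hiding ([_])
open import Relation.Binary.Definitions using (tri<; tri≈; tri>)
open import Data.List using (List; []; _∷_; _++_; map; length; [_])
open import Data.List.Properties using (++-assoc; ++-identityʳ; length-++; ∷-injectiveʳ; map-cong-local)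
open import Data.List.Relation.Binary.Sublist.Propositional using (_⊆_; []; _∷_; _∷ʳ_; minimum; from∈; to∈; ⊆-refl; ⊆-trans)
import Data.List.Relation.Binary.Sublist.Propositional.Properties as Sublist
open import Data.List.Membership.Propositional using (_∈_; _∉_; find; lose)
open import Data.List.Membership.Propositional.Properties using (∈-++⁺ˡ; ∈-++⁺ʳ; ∈-++⁻; ∈-map⁺; ∈-map⁻; ∈-∃++; ∈-upTo⁺; ∈-upTo⁻)
open import Data.List.Relation.Unary.Any using (here; there)
open import Data.List.Relation.Unary.Any.Properties using (any⁺; any⁻)
open import Data.List.Relation.Unary.All as All using (All; []; _∷_)
open import Data.List.Relation.Unary.AllPairs as AllPairs using (AllPairs; []; _∷_)
import Data.List.Relation.Unary.AllPairs.Properties as AllPairs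
open import Data.List.Relation.Unary.Linked using (Linked)
open import Data.List.Relation.Unary.Linked.Properties using (AllPairs⇒Linked)
open import Data.List.Relation.Unary.Sorted.TotalOrder.Properties using (↗↭↗⇒≋)
open import Data.List.Relation.Unary.Unique.Propositional using (Unique)
open import Data.List.Relation.Unary.Unique.Propositional.Properties using (Unique[x∷xs]⇒x∉xs)
open import Data.List.Relation.Binary.Equality.Propositional using (≋⇒≡)
open import Data.List.Relation.Binary.Permutation.Propositional using (_↭_; ↭-sym; ↭-trans; ↭-reflexive; ↭⇒↭ₛ)
open import Data.List.Relation.Binary.Permutation.Propositional.Properties using (∈-resp-↭; ++⁺ˡ; shift; ↭-empty-inv)
import Data.List.Relation.Binary.Permutation.Setoid.Properties as Permutationₛ
open import Data.List.Relation.Unary.All.Properties using (¬All⇒Any¬)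
import Relation.Unary as U
open import Function.Bundles using (_⇔_; mk⇔; Equivalence)
open import Function.Construct.Symmetry using (⇔-sym)
import Function.Related.Propositional as Related
open import Data.Product.Function.NonDependent.Propositional using (_×-⇔_)

private variable
  A : Set
  x y z : A
  xs ys w : List A

-- Sublists of length two and three

∷⊆-split : (x ∷ xs) ⊆ ys → ∃₂ λ (P R : List A) → ys ≡ P ++ x ∷ R × xs ⊆ R
∷⊆-split (y ∷ʳ p) with ∷⊆-split p
... | P , R , refl , q = y ∷ P , R , refl , q
∷⊆-split (refl ∷ p) = [] , _ , refl , p

pair⊆-split : (x ∷ y ∷ []) ⊆ w → ∃₂ λ (P M : List A) → ∃ λ Q → w ≡ P ++ x ∷ M ++ y ∷ Q
pair⊆-split p with ∷⊆-split p
... | P , R , refl , q with ∷⊆-split q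
... | M , Q , refl , _ = P , M , Q , refl

pair⊆-++⁺ : x ∈ xs → y ∈ ys → (x ∷ y ∷ []) ⊆ xs ++ ys
pair⊆-++⁺ i j = Sublist.++⁺ (from∈ i) (from∈ j)

pair⊆-++⁻ : ∀ xs → (x ∷ y ∷ []) ⊆ xs ++ ys →
  (x ∷ y ∷ []) ⊆ xs ⊎ (x ∈ xs × y ∈ ys) ⊎ (x ∷ y ∷ []) ⊆ ys
pair⊆-++⁻ [] p = inj₂ (inj₂ p)
pair⊆-++⁻ (x ∷ xs) (.x ∷ʳ p) with pair⊆-++⁻ xs p
... | inj₁ q = inj₁ (x ∷ʳ q)
... | inj₂ (inj₁ (i , j)) = inj₂ (inj₁ (there i , j))
... | inj₂ (inj₂ q) = inj₂ (inj₂ q)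
pair⊆-++⁻ (x ∷ xs) (refl ∷ p) with ∈-++⁻ xs (to∈ p)
... | inj₁ i = inj₁ (refl ∷ from∈ i)
... | inj₂ j = inj₂ (inj₁ (here refl , j))

pair⊆-total : x ∈ w → y ∈ w → x ≢ y → (x ∷ y ∷ []) ⊆ w ⊎ (y ∷ x ∷ []) ⊆ w
pair⊆-total (here refl) (here refl) x≢y = ⊥-elim (x≢y refl)
pair⊆-total (here refl) (there j) _ = inj₁ (refl ∷ from∈ j)
pair⊆-total (there i) (here refl) _ = inj₂ (refl ∷ from∈ i)
pair⊆-total {w = v ∷ w} (there i) (there j) x≢y with pair⊆-total i j x≢y
... | inj₁ p = inj₁ (v ∷ʳ p)
... | inj₂ p = inj₂ (v ∷ʳ p)

triple⊆⇒₁₂ : (x ∷ y ∷ z ∷ []) ⊆ w → (x ∷ y ∷ []) ⊆ w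
triple⊆⇒₁₂ = ⊆-trans (refl ∷ refl ∷ _ ∷ʳ [])

triple⊆⇒₁₃ : (x ∷ y ∷ z ∷ []) ⊆ w → (x ∷ z ∷ []) ⊆ w
triple⊆⇒₁₃ = ⊆-trans (refl ∷ _ ∷ʳ refl ∷ [])

triple⊆⇒₂₃ : (x ∷ y ∷ z ∷ []) ⊆ w → (y ∷ z ∷ []) ⊆ w
triple⊆⇒₂₃ = Sublist.∷ˡ⁻

AllPairs-⊆ : ∀ {R : A → A → Set} → xs ⊆ ys → AllPairs R ys → AllPairs R xs
AllPairs-⊆ [] _ = []
AllPairs-⊆ (y ∷ʳ p) (_ ∷ r) = AllPairs-⊆ p r
AllPairs-⊆ (refl ∷ p) (h ∷ r) = Sublist.All-resp-⊆ p h ∷ AllPairs-⊆ p r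

AllPairs-pair⊆ : ∀ {R : A → A → Set} → AllPairs R w → (x ∷ y ∷ []) ⊆ w → R x y
AllPairs-pair⊆ r p with AllPairs-⊆ p r
... | (rxy ∷ []) ∷ _ = rxy

Unique-pair⊆-antisym : Unique w → (x ∷ y ∷ []) ⊆ w → (y ∷ x ∷ []) ⊆ w → ⊥
Unique-pair⊆-antisym (_ ∷ u) (v ∷ʳ p) (.v ∷ʳ q) = Unique-pair⊆-antisym u p q
Unique-pair⊆-antisym u (_ ∷ʳ p) (refl ∷ q) = Unique[x∷xs]⇒x∉xs u (to∈ (Sublist.∷ˡ⁻ p))
Unique-pair⊆-antisym u (refl ∷ p) (_ ∷ʳ q) = Unique[x∷xs]⇒x∉xs u (to∈ (Sublist.∷ˡ⁻ q))
Unique-pair⊆-antisym u (refl ∷ p) (refl ∷ q) = Unique[x∷xs]⇒x∉xs u (to∈ p)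

Unique-pair⊆-join : Unique w → (x ∷ y ∷ []) ⊆ w → (y ∷ z ∷ []) ⊆ w → (x ∷ y ∷ z ∷ []) ⊆ w
Unique-pair⊆-join (_ ∷ u) (v ∷ʳ p) (.v ∷ʳ q) = v ∷ʳ Unique-pair⊆-join u p q
Unique-pair⊆-join u (_ ∷ʳ p) (refl ∷ q) = ⊥-elim (Unique[x∷xs]⇒x∉xs u (to∈ (Sublist.∷ˡ⁻ p)))
Unique-pair⊆-join u (refl ∷ p) (_ ∷ʳ q) = refl ∷ q
Unique-pair⊆-join u (refl ∷ p) (refl ∷ q) = ⊥-elim (Unique[x∷xs]⇒x∉xs u (to∈ p))

Unique-++-disjoint : ∀ P {R} → Unique (P ++ R) → x ∈ P → y ∈ R → x ≢ y
Unique-++-disjoint (_ ∷ P) (h ∷ u) (here refl) j = All.lookup h (∈-++⁺ʳ P j)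
Unique-++-disjoint (_ ∷ P) (h ∷ u) (there i) j = Unique-++-disjoint P u i j

Unique-mid-∉ : ∀ P {R} → Unique (P ++ x ∷ R) → x ∉ P
Unique-mid-∉ P u i = Unique-++-disjoint P u i (here refl) refl

Unique-resp-↭ : xs ↭ ys → Unique xs → Unique ys
Unique-resp-↭ p = Permutationₛ.Unique-resp-↭ (setoid _) (↭⇒↭ₛ p)

Strict⇒Unique : ∀ {xs} → AllPairs _<_ xs → Unique xs
Strict⇒Unique = AllPairs.map (λ x<y x≡y → <-irrefl x≡y x<y)

Strict-↭⇒≡ : ∀ {xs ys} → AllPairs _<_ xs → AllPairs _<_ ys → xs ↭ ys → xs ≡ ys
Strict-↭⇒≡ s t p = ≋⇒≡ (↗↭↗⇒≋ ≤-totalOrder (sorted s) (sorted t) (↭⇒↭ₛ p))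
  where
  sorted : ∀ {zs} → AllPairs _<_ zs → Linked _≤_ zs
  sorted r = AllPairs⇒Linked (AllPairs.map <⇒≤ r)

Strict-pair⊆ : ∀ {w a b} → AllPairs _<_ w → a ∈ w → b ∈ w → a < b → (a ∷ b ∷ []) ⊆ w
Strict-pair⊆ w↑ a∈ b∈ a<b with pair⊆-total a∈ b∈ (<⇒≢ a<b)
... | inj₁ ab = ab
... | inj₂ ba = ⊥-elim (<-asym a<b (AllPairs-pair⊆ w↑ ba))

range-strict : ∀ n → AllPairs _<_ (range n)
range-strict n = AllPairs.map⁺ (AllPairs.applyUpTo⁺₁ (λ i → i) n (λ i<j _ → s≤s i<j))

∈-range⁻ : ∀ {n v} → v ∈ range n → 0 < v × v ≤ n
∈-range⁻ i with ∈-map⁻ suc i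
... | u , j , refl = s≤s z≤n , ∈-upTo⁻ j

∈-range⁺ : ∀ {n v} → 0 < v → v ≤ n → v ∈ range n
∈-range⁺ {v = suc v} _ v≤n = ∈-map⁺ suc (∈-upTo⁺ v≤n)
all-or-counterexample : ∀ {P : ℕ → Set} → U.Decidable P → ∀ xs → All P xs ⊎ ∃ λ x → x ∈ xs × ¬ P x
all-or-counterexample P? xs with All.all? P? xs
... | yes all = inj₁ all
... | no ¬all = inj₂ (find (¬All⇒Any¬ P? xs ¬all))

adjacent-straddle : ∀ {P : ℕ → Set} B s₀ N y → s₀ < B → B < y → All (_≢ B) N → All P N → P y →
  ∃₂ λ S₁ S₂ → ∃₂ λ A C → s₀ ∷ N ++ y ∷ [] ≡ S₁ ++ A ∷ C ∷ S₂ × A < B × B < C × P C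
adjacent-straddle B s₀ [] y s₀<B B<y _ _ Py = [] , [] , s₀ , y , refl , s₀<B , B<y , Py
adjacent-straddle B s₀ (m ∷ N) y s₀<B B<y (m≢B ∷ N≢B) (Pm ∷ PN) Py with <-cmp m B
... | tri≈ _ m≡B _ = ⊥-elim (m≢B m≡B)
... | tri> _ _ B<m = [] , N ++ y ∷ [] , s₀ , m , refl , s₀<B , B<m , Pm
... | tri< m<B _ _ with adjacent-straddle B m N y m<B B<y N≢B PN Py
...   | S₁ , S₂ , A , C , eq , A<B , B<C , PC = s₀ ∷ S₁ , S₂ , A , C , cong (s₀ ∷_) eq , A<B , B<C , PC


-- Pattern containment

<ᵇ≡true : ∀ {m n} → m < n → (m <ᵇ n) ≡ true
<ᵇ≡true m<n = Equivalence.to T-≡ (<⇒<ᵇ m<n)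

<ᵇ≡false : ∀ {m n} → ¬ m < n → (m <ᵇ n) ≡ false
<ᵇ≡false {m} {n} m≮n with m <ᵇ n | <ᵇ-reflects-< m n
... | true | ofʸ m<n = ⊥-elim (m≮n m<n)
... | false | _ = refl

subseqs-⊆ : ∀ k w {q : List ℕ} → q ∈ subseqs k w → q ⊆ w
subseqs-⊆ zero w (here refl) = minimum w
subseqs-⊆ (suc k) (x ∷ w) i with ∈-++⁻ (map (x ∷_) (subseqs k w)) i
... | inj₂ j = x ∷ʳ subseqs-⊆ (suc k) w j
... | inj₁ j with ∈-map⁻ (x ∷_) j
... | q , j′ , refl = refl ∷ subseqs-⊆ k w j′

subseqs-complete : ∀ {q w : List ℕ} → q ⊆ w → q ∈ subseqs (length q) w
subseqs-complete {[]} {[]} [] = here refl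
subseqs-complete {[]} {y ∷ w} _ = here refl
subseqs-complete {x ∷ q} {.x ∷ w} (refl ∷ p) = ∈-++⁺ˡ (∈-map⁺ (x ∷_) (subseqs-complete p))
subseqs-complete {x ∷ q} {y ∷ w} (.y ∷ʳ p) =
  ∈-++⁺ʳ (map (y ∷_) (subseqs (length q) w)) (subseqs-complete p)

orderIso-length : ∀ p q → T (orderIso p q) → length p ≡ length q
orderIso-length [] [] _ = refl
orderIso-length (_ ∷ p) (_ ∷ q) h = cong suc (orderIso-length p q (proj₂ (Equivalence.to T-∧ h)))

containsSome⁺ : ∀ P w {p q} → p ∈ P → q ⊆ w → T (orderIso p q) → T (containsSome P w)
containsSome⁺ P w {p} {q} i s h = any⁺ _ (lose i (any⁺ _ (lose q∈ h)))
  where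
  q∈ : q ∈ subseqs (length p) w
  q∈ = subst (λ n → q ∈ subseqs n w) (sym (orderIso-length p q h)) (subseqs-complete s)

containsSome⁻ : ∀ P w → T (containsSome P w) → ∃₂ λ (p q : List ℕ) → p ∈ P × q ⊆ w × T (orderIso p q)
containsSome⁻ P w h with find (any⁻ (contains w) P h)
... | p , i , h′ with find (any⁻ (orderIso p) (subseqs (length p) w) h′)
... | q , j , iso = p , q , i , subseqs-⊆ (length p) w j , iso

orderIso-pair : ∀ {p₁ p₂} q → T (orderIso (p₁ ∷ p₂ ∷ []) q) → ∃₂ λ a b → q ≡ a ∷ b ∷ []
orderIso-pair {p₁} {p₂} q h with orderIso-length (p₁ ∷ p₂ ∷ []) q h
orderIso-pair (a ∷ b ∷ []) h | refl = a , b , refl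

orderIso-triple : ∀ {p₁ p₂ p₃} q → T (orderIso (p₁ ∷ p₂ ∷ p₃ ∷ []) q) → ∃₂ λ a b → ∃ λ c → q ≡ a ∷ b ∷ c ∷ []
orderIso-triple {p₁} {p₂} {p₃} q h with orderIso-length (p₁ ∷ p₂ ∷ p₃ ∷ []) q h
orderIso-triple (a ∷ b ∷ c ∷ []) h | refl = a , b , c , refl

orderIso-21⁻ : ∀ {a b} → T (orderIso (2 ∷ 1 ∷ []) (a ∷ b ∷ [])) → ¬ a < b
orderIso-21⁻ {a} {b} h with a <ᵇ b | <ᵇ-reflects-< a b
... | false | ofⁿ a≮b = a≮b

orderIso-21⁺ : ∀ {a b} → b < a → T (orderIso (2 ∷ 1 ∷ []) (a ∷ b ∷ []))
orderIso-21⁺ b<a rewrite <ᵇ≡false (<⇒≯ b<a) = tt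

orderIso-123⁻ : ∀ {a b c} → T (orderIso (1 ∷ 2 ∷ 3 ∷ []) (a ∷ b ∷ c ∷ [])) → a < b × b < c
orderIso-123⁻ {a} {b} {c} h with a <ᵇ b | <ᵇ-reflects-< a b | a <ᵇ c | b <ᵇ c | <ᵇ-reflects-< b c
... | true | ofʸ a<b | true | true | ofʸ b<c = a<b , b<c
... | true | _ | true | false | _ = ⊥-elim h
... | true | _ | false | _ | _ = ⊥-elim h

orderIso-123⁺ : ∀ {a b c} → a < b → b < c → T (orderIso (1 ∷ 2 ∷ 3 ∷ []) (a ∷ b ∷ c ∷ []))
orderIso-123⁺ a<b b<c rewrite <ᵇ≡true a<b | <ᵇ≡true (<-trans a<b b<c) | <ᵇ≡true b<c = tt

orderIso-312⁻ : ∀ {a b c} → T (orderIso (3 ∷ 1 ∷ 2 ∷ []) (a ∷ b ∷ c ∷ [])) → ¬ a < b × ¬ a < c × b < c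
orderIso-312⁻ {a} {b} {c} h
  with a <ᵇ b | <ᵇ-reflects-< a b | a <ᵇ c | <ᵇ-reflects-< a c | b <ᵇ c | <ᵇ-reflects-< b c
... | false | ofⁿ a≮b | false | ofⁿ a≮c | true | ofʸ b<c = a≮b , a≮c , b<c
... | false | _ | false | _ | false | _ = ⊥-elim h
... | false | _ | true | _ | _ | _ = ⊥-elim h

orderIso-312⁺ : ∀ {a b c} → b < a → c < a → b < c → T (orderIso (3 ∷ 1 ∷ 2 ∷ []) (a ∷ b ∷ c ∷ []))
orderIso-312⁺ b<a c<a b<c rewrite <ᵇ≡false (<⇒≯ b<a) | <ᵇ≡false (<⇒≯ c<a) | <ᵇ≡true b<c = tt

-- Greedy stack runs

State : Set
State = List ℕ × List ℕ

run : List (List ℕ) → List ℕ → State → State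
run P [] st = st
run P (x ∷ xs) (s , o) = run P xs (pushGreedy P x s o)

flush : State → List ℕ
flush (s , o) = o ++ s

run-++ : ∀ P xs ys st → run P (xs ++ ys) st ≡ run P ys (run P xs st)
run-++ P [] ys st = refl
run-++ P (x ∷ xs) ys (s , o) = run-++ P xs ys (pushGreedy P x s o)

runStack≡flush∘run : ∀ P xs s o → runStack P xs s o ≡ flush (run P xs (s , o))
runStack≡flush∘run P [] s o = refl
runStack≡flush∘run P (x ∷ xs) s o = runStack≡flush∘run P xs _ _

pushGreedy-pop : ∀ P x t s o → T (containsSome P (x ∷ t ∷ s)) →
  pushGreedy P x (t ∷ s) o ≡ pushGreedy P x s (o ++ t ∷ [])
pushGreedy-pop P x t s o h with containsSome P (x ∷ t ∷ s)
... | true = refl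

pushGreedy-push : ∀ P x t s o → ¬ T (containsSome P (x ∷ t ∷ s)) → pushGreedy P x (t ∷ s) o ≡ (x ∷ t ∷ s , o)
pushGreedy-push P x t s o h with containsSome P (x ∷ t ∷ s)
... | true = ⊥-elim (h tt)
... | false = refl

pushGreedy-shape : ∀ P x s o → ∃₂ λ popped rest → s ≡ popped ++ rest × pushGreedy P x s o ≡ (x ∷ rest , o ++ popped)
pushGreedy-shape P x [] o = [] , [] , refl , cong (x ∷ [] ,_) (sym (++-identityʳ o))
pushGreedy-shape P x (t ∷ s) o with containsSome P (x ∷ t ∷ s)
... | false = [] , t ∷ s , refl , cong (x ∷ t ∷ s ,_) (sym (++-identityʳ o))
... | true with pushGreedy-shape P x s (o ++ t ∷ [])
... | popped , rest , refl , eq = t ∷ popped , rest , refl , trans eq (cong (x ∷ rest ,_) (++-assoc o _ popped))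

flush-run-↭ : ∀ P xs s o → ∃ λ X → flush (run P xs (s , o)) ≡ o ++ X × X ↭ s ++ xs
flush-run-↭ P [] s o = s , refl , ↭-reflexive (sym (++-identityʳ s))
flush-run-↭ P (x ∷ xs) s o with pushGreedy-shape P x s o
... | popped , rest , refl , eq rewrite eq with flush-run-↭ P xs (x ∷ rest) (o ++ popped)
... | X , eq′ , X↭ = popped ++ X , trans eq′ (++-assoc o popped X) ,
      ↭-trans (++⁺ˡ popped X↭) (↭-trans (++⁺ˡ popped (↭-sym (shift x rest xs)))
        (↭-reflexive (sym (++-assoc popped rest (x ∷ xs)))))

output-before-pending : ∀ P xs s o {u v} → u ∈ o → v ∈ s ++ xs → (u ∷ v ∷ []) ⊆ flush (run P xs (s , o))
output-before-pending P xs s o u∈o v∈ with flush-run-↭ P xs s o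
... | X , eq , X↭ rewrite eq = pair⊆-++⁺ u∈o (∈-resp-↭ (↭-sym X↭) v∈)

-- A stack never reorders its entries: once v is above u, v reaches the output first.
PrecedesIn : ℕ → ℕ → State → Set
PrecedesIn v u (s , o) = (v ∷ u ∷ []) ⊆ s ⊎ (v ∈ o × u ∈ s) ⊎ (v ∷ u ∷ []) ⊆ o

PrecedesIn-push : ∀ P x v u s o → PrecedesIn v u (s , o) → PrecedesIn v u (pushGreedy P x s o)
PrecedesIn-push P x v u s o prec with pushGreedy-shape P x s o
... | popped , rest , refl , eq rewrite eq with prec
... | inj₂ (inj₂ q) = inj₂ (inj₂ (Sublist.++⁺ʳ popped q))
... | inj₂ (inj₁ (v∈o , u∈s)) with ∈-++⁻ popped u∈s
...   | inj₁ u∈p = inj₂ (inj₂ (pair⊆-++⁺ v∈o u∈p))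
...   | inj₂ u∈r = inj₂ (inj₁ (∈-++⁺ˡ v∈o , there u∈r))
PrecedesIn-push P x v u s o prec | popped , rest , refl , eq | inj₁ q with pair⊆-++⁻ popped q
... | inj₁ q′ = inj₂ (inj₂ (Sublist.++⁺ˡ o q′))
... | inj₂ (inj₁ (v∈p , u∈r)) = inj₂ (inj₁ (∈-++⁺ʳ o v∈p , there u∈r))
... | inj₂ (inj₂ q′) = inj₁ (x ∷ʳ q′)

PrecedesIn-flush : ∀ P xs v u st → PrecedesIn v u st → (v ∷ u ∷ []) ⊆ flush (run P xs st)
PrecedesIn-flush P [] v u (s , o) (inj₁ q) = Sublist.++⁺ˡ o q
PrecedesIn-flush P [] v u (s , o) (inj₂ (inj₁ (v∈o , u∈s))) = pair⊆-++⁺ v∈o u∈s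
PrecedesIn-flush P [] v u (s , o) (inj₂ (inj₂ q)) = Sublist.++⁺ʳ s q
PrecedesIn-flush P (x ∷ xs) v u (s , o) prec = PrecedesIn-flush P xs v u _ (PrecedesIn-push P x v u s o prec)

stack-order-kept : ∀ P xs s o {v u} → (v ∷ u ∷ []) ⊆ s → (v ∷ u ∷ []) ⊆ flush (run P xs (s , o))
stack-order-kept P xs s o q = PrecedesIn-flush P xs _ _ (s , o) (inj₁ q)

run-invariant : ∀ P (F : List ℕ) (I : List ℕ → List ℕ → State → Set) →
  (∀ D x R st → F ≡ D ++ x ∷ R → I D (x ∷ R) st → I (D ++ [ x ]) R (pushGreedy P x (proj₁ st) (proj₂ st))) →
  ∀ st₀ → I [] F st₀ → ∀ D R → F ≡ D ++ R → I D R (run P D st₀)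
run-invariant P F I step st₀ i₀ D R eq = go D [] R st₀ eq (subst (λ z → I [] z st₀) eq i₀)
  where
  go : ∀ D₂ D₁ R st → F ≡ D₁ ++ D₂ ++ R → I D₁ (D₂ ++ R) st → I (D₁ ++ D₂) R (run P D₂ st)
  go [] D₁ R st eq i = subst (λ z → I z R st) (sym (++-identityʳ D₁)) i
  go (x ∷ D₂) D₁ R st eq i =
    subst (λ z → I z R (run P D₂ (pushGreedy P x (proj₁ st) (proj₂ st)))) (++-assoc D₁ [ x ] D₂)
      (go D₂ (D₁ ++ [ x ]) R _ (trans eq (sym (++-assoc D₁ [ x ] (D₂ ++ R)))) (step D₁ x (D₂ ++ R) st eq i))

Processed : List ℕ → State → Set
Processed D (s , o) = (∀ a → a ∈ s → a ∈ D) × (∀ a → a ∈ D → a ∈ o ⊎ a ∈ s)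

Processed-push : ∀ P D x s o → Processed D (s , o) → Processed (D ++ [ x ]) (pushGreedy P x s o)
Processed-push P D x s o (s⊆D , D⊆o∪s) with pushGreedy-shape P x s o
... | popped , rest , refl , eq rewrite eq = s′⊆D′ , D′⊆o′∪s′
  where
  s′⊆D′ : ∀ a → a ∈ x ∷ rest → a ∈ D ++ [ x ]
  s′⊆D′ a (here refl) = ∈-++⁺ʳ D (here refl)
  s′⊆D′ a (there i) = ∈-++⁺ˡ (s⊆D a (∈-++⁺ʳ popped i))
  D′⊆o′∪s′ : ∀ a → a ∈ D ++ [ x ] → a ∈ o ++ popped ⊎ a ∈ x ∷ rest
  D′⊆o′∪s′ a i with ∈-++⁻ D i
  ... | inj₂ (here refl) = inj₂ (here refl)
  ... | inj₁ j with D⊆o∪s a j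
  ... | inj₁ k = inj₁ (∈-++⁺ˡ k)
  ... | inj₂ k with ∈-++⁻ popped k
  ... | inj₁ k′ = inj₁ (∈-++⁺ʳ o k′)
  ... | inj₂ k′ = inj₂ (there k′)

record Push (P : List (List ℕ)) (x : ℕ) (s o : List ℕ) (Popped Kept : ℕ → Set) : Set where
  constructor pushed
  field
    popped kept : List ℕ
    split : s ≡ popped ++ kept
    result : pushGreedy P x s o ≡ (x ∷ kept , o ++ popped)
    all-popped : All Popped popped
    all-kept : All Kept kept

Push-stop : ∀ {P x s o Popped Kept} → ¬ T (containsSome P (x ∷ s)) → All Kept s → Push P x s o Popped Kept
Push-stop {s = []} {o} _ [] = pushed [] [] refl (cong (_ ∷ [] ,_) (sym (++-identityʳ o))) [] []
Push-stop {P} {x} {t ∷ s} {o} h ks =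
  pushed [] (t ∷ s) refl (trans (pushGreedy-push P x t s o h) (cong (x ∷ t ∷ s ,_) (sym (++-identityʳ o)))) [] ks

Push-pop : ∀ {P x t s o Popped Kept} → T (containsSome P (x ∷ t ∷ s)) → Popped t →
  Push P x s (o ++ t ∷ []) Popped Kept → Push P x (t ∷ s) o Popped Kept
Push-pop {P} {x} {t} {o = o} h pt (pushed hi lo refl eq ahi alo) =
  pushed (t ∷ hi) lo refl (trans (pushGreedy-pop P x t (hi ++ lo) o h) (trans eq (cong (x ∷ lo ,_) (++-assoc o _ hi))))
    (pt ∷ ahi) alo

-- The classical stack

T21 : List (List ℕ)
T21 = (2 ∷ 1 ∷ []) ∷ []

increasing⇒¬21 : ∀ {w} → AllPairs _<_ w → ¬ T (containsSome T21 w)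
increasing⇒¬21 {w} inc h with containsSome⁻ T21 w h
... | _ , q , here refl , q⊆w , iso with orderIso-pair q iso
... | a , b , refl = orderIso-21⁻ iso (AllPairs-pair⊆ inc q⊆w)

push21 : ∀ c s o → AllPairs _<_ s → c ∉ s → Push T21 c s o (_< c) (c <_)
push21 c [] o _ _ = Push-stop (λ ()) []
push21 c (t ∷ s) o (t<s ∷ inc) c∉ with <-cmp t c
... | tri≈ _ t≡c _ = ⊥-elim (c∉ (here (sym t≡c)))
... | tri> _ _ c<t = Push-stop (increasing⇒¬21 (c<t∷s ∷ t<s ∷ inc)) c<t∷s
  where c<t∷s = c<t ∷ All.map (<-trans c<t) t<s
... | tri< t<c _ _ =
  Push-pop (containsSome⁺ T21 (c ∷ t ∷ s) {q = c ∷ t ∷ []} (here refl) (refl ∷ refl ∷ minimum _) (orderIso-21⁺ t<c))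
  t<c (push21 c s (o ++ t ∷ []) inc (λ i → c∉ (there i)))

Avoids231 : List ℕ → Set
Avoids231 F = ∀ x y z → (x ∷ y ∷ z ∷ []) ⊆ F → z < x → x < y → ⊥

IncreasingStack : List ℕ → List ℕ → State → Set
IncreasingStack D R st = Processed D st × AllPairs _<_ (proj₁ st)

IncreasingStack-push : ∀ F → Unique F → ∀ D x R st → F ≡ D ++ x ∷ R → IncreasingStack D (x ∷ R) st →
  IncreasingStack (D ++ [ x ]) R (pushGreedy T21 x (proj₁ st) (proj₂ st))
IncreasingStack-push F u D x R (s , o) refl (proc , inc)
  with push21 x s o inc (λ i → Unique-mid-∉ D u (proj₁ proc x i))
... | pushed hi lo refl eq _ x<lo =
  Processed-push T21 D x (hi ++ lo) o proc ,
  subst (λ st → AllPairs _<_ (proj₁ st)) (sym eq) (x<lo ∷ AllPairs-⊆ (Sublist.++⁺ˡ hi ⊆-refl) inc)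

-- When y is pushed it pops every smaller stack entry, in particular an earlier x < y;
-- a later z < x is then output after x.
classicalStack-sorts⇒avoids231 : ∀ F n → Unique F → TStack T21 F ≡ range n → Avoids231 F
classicalStack-sorts⇒avoids231 F n u sorts x y z xyz⊆F z<x x<y with ∷⊆-split xyz⊆F
... | D₁ , _ , refl , yz⊆ with ∷⊆-split yz⊆
... | M , R , refl , z⊆R = <-asym z<x x<z
  where
  D = D₁ ++ x ∷ M
  F≡ : D₁ ++ x ∷ M ++ y ∷ R ≡ D ++ y ∷ R
  F≡ = sym (++-assoc D₁ (x ∷ M) (y ∷ R))
  st = run T21 D ([] , [])
  inv : IncreasingStack D (y ∷ R) st
  inv = run-invariant T21 _ IncreasingStack (IncreasingStack-push _ u) ([] , []) (((λ _ ()) , (λ _ ())) , []) D (y ∷ R) F≡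
  pushY = push21 y (proj₁ st) (proj₂ st) (proj₂ inv)
    (λ i → Unique-mid-∉ D (subst Unique F≡ u) (proj₁ (proj₁ inv) y i))
  open Push pushY renaming (popped to hi; kept to lo)
  x∈out : x ∈ proj₂ st ++ hi
  x∈out with proj₂ (proj₁ inv) x (∈-++⁺ʳ D₁ (here refl))
  ... | inj₁ i = ∈-++⁺ˡ i
  ... | inj₂ i with ∈-++⁻ hi (subst (x ∈_) split i)
  ...   | inj₁ j = ∈-++⁺ʳ _ j
  ...   | inj₂ j = ⊥-elim (<-asym x<y (All.lookup all-kept j))
  output≡ : TStack T21 (D₁ ++ x ∷ M ++ y ∷ R) ≡ flush (run T21 R (y ∷ lo , proj₂ st ++ hi))
  output≡ = begin
    TStack T21 (D₁ ++ x ∷ M ++ y ∷ R)                      ≡⟨ runStack≡flush∘run T21 (D₁ ++ x ∷ M ++ y ∷ R) [] [] ⟩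
    flush (run T21 (D₁ ++ x ∷ M ++ y ∷ R) ([] , []))       ≡⟨ cong (λ w → flush (run T21 w ([] , []))) F≡ ⟩
    flush (run T21 (D ++ y ∷ R) ([] , []))                 ≡⟨ cong flush (run-++ T21 D (y ∷ R) ([] , [])) ⟩
    flush (run T21 R (pushGreedy T21 y (proj₁ st) (proj₂ st))) ≡⟨ cong (λ st′ → flush (run T21 R st′)) result ⟩
    flush (run T21 R (y ∷ lo , proj₂ st ++ hi))            ∎
    where open ≡-Reasoning
  x<z : x < z
  x<z = AllPairs-pair⊆ (range-strict n) (subst ((x ∷ z ∷ []) ⊆_) (trans (sym output≡) sorts)
          (output-before-pending T21 R (y ∷ lo) (proj₂ st ++ hi) x∈out (∈-++⁺ʳ (y ∷ lo) (to∈ z⊆R))))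

record SortingRun (D R : List ℕ) (st : State) : Set where
  field
    processed : Processed D st
    stack↑ : AllPairs _<_ (proj₁ st)
    output↑ : AllPairs _<_ (proj₂ st)
    output<stack : ∀ {a b} → a ∈ proj₂ st → b ∈ proj₁ st → a < b
    output<input : ∀ {a b} → a ∈ proj₂ st → b ∈ R → a < b

SortingRun-push : ∀ F → Unique F → Avoids231 F → ∀ D x R st → F ≡ D ++ x ∷ R → SortingRun D (x ∷ R) st →
  SortingRun (D ++ [ x ]) R (pushGreedy T21 x (proj₁ st) (proj₂ st))
SortingRun-push F u av D x R (s , o) refl sr
  with push21 x s o stack↑ (λ i → Unique-mid-∉ D u (proj₁ processed x i))
  where open SortingRun sr
... | pushed hi lo refl eq hi<x x<lo = subst (SortingRun (D ++ [ x ]) R) (sym eq) record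
  { processed = subst (Processed (D ++ [ x ])) eq (Processed-push T21 D x (hi ++ lo) o processed)
  ; stack↑ = x<lo ∷ AllPairs-⊆ (Sublist.++⁺ˡ hi ⊆-refl) stack↑
  ; output↑ = AllPairs.++⁺ output↑ (AllPairs-⊆ (Sublist.++⁺ʳ lo ⊆-refl) stack↑)
      (All.tabulate λ a∈o → All.tabulate λ b∈hi → output<stack a∈o (∈-++⁺ˡ b∈hi))
  ; output<stack = output<stack′
  ; output<input = output<input′
  }
  where
  open SortingRun sr
  output<stack′ : ∀ {a b} → a ∈ o ++ hi → b ∈ x ∷ lo → a < b
  output<stack′ a∈ b∈ with ∈-++⁻ o a∈ | b∈
  ... | inj₁ a∈o | here refl = output<input a∈o (here refl)
  ... | inj₁ a∈o | there b∈lo = output<stack a∈o (∈-++⁺ʳ hi b∈lo)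
  ... | inj₂ a∈hi | here refl = All.lookup hi<x a∈hi
  ... | inj₂ a∈hi | there b∈lo = AllPairs-pair⊆ stack↑ (pair⊆-++⁺ a∈hi b∈lo)
  -- an entry popped by x that exceeded a later input b would form 231 with x and b
  output<input′ : ∀ {a b} → a ∈ o ++ hi → b ∈ R → a < b
  output<input′ {a} {b} a∈ b∈R with ∈-++⁻ o a∈
  ... | inj₁ a∈o = output<input a∈o (there b∈R)
  ... | inj₂ a∈hi with <-cmp a b
  ...   | tri< a<b _ _ = a<b
  ...   | tri≈ _ a≡b _ = ⊥-elim (Unique-++-disjoint D u (proj₁ processed a (∈-++⁺ˡ a∈hi)) (there b∈R) a≡b)
  ...   | tri> _ _ b<a = ⊥-elim (av a x b (Sublist.++⁺ (from∈ (proj₁ processed a (∈-++⁺ˡ a∈hi))) (refl ∷ from∈ b∈R))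
                                     b<a (All.lookup hi<x a∈hi))

avoids231⇒classicalStack-sorts : ∀ F n → Unique F → F ↭ range n → Avoids231 F → TStack T21 F ≡ range n
avoids231⇒classicalStack-sorts F n u F↭ av =
  trans (runStack≡flush∘run T21 F [] []) (Strict-↭⇒≡ flush↑ (range-strict n) (↭-trans flush↭F F↭))
  where
  final : SortingRun F [] (run T21 F ([] , []))
  final = run-invariant T21 F SortingRun (SortingRun-push F u av) ([] , [])
    (record { processed = (λ _ ()) , (λ _ ()) ; stack↑ = [] ; output↑ = []
            ; output<stack = λ () ; output<input = λ () })
    F [] (sym (++-identityʳ F))
  open SortingRun final
  flush↑ : AllPairs _<_ (flush (run T21 F ([] , [])))
  flush↑ = AllPairs.++⁺ output↑ stack↑ (All.tabulate λ a∈o → All.tabulate λ b∈s → output<stack a∈o b∈s)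
  flush↭F : flush (run T21 F ([] , [])) ↭ F
  flush↭F with flush-run-↭ T21 F [] []
  ... | X , eq , X↭ = subst (_↭ F) (sym eq) X↭


-- The {123,312}-stack on input k ρ

-- Above k a b: a may lie above b in the stack. Entries smaller than k sit above the others and
-- each layer decreases from top to bottom, so k stays at the bottom.
Above : ℕ → ℕ → ℕ → Set
Above k a b = (a < k × k ≤ b) ⊎ (b < a × (a < k ⊎ k ≤ b))

Outside : ℕ → ℕ → ℕ → Set
Outside k x u = u < x ⊎ k ≤ u

Above-¬123 : ∀ {k a b c} → Above k a b → Above k b c → a < b → b < c → ⊥
Above-¬123 (inj₁ (_ , k≤b)) (inj₁ (b<k , _)) _ _ = <-irrefl refl (<-≤-trans b<k k≤b)
Above-¬123 (inj₁ _) (inj₂ (c<b , _)) _ b<c = <-asym c<b b<c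
Above-¬123 (inj₂ (b<a , _)) _ a<b _ = <-asym a<b b<a

Above-¬312 : ∀ {k a b c} → Above k a b → Above k b c → Above k a c → ¬ a < b → ¬ a < c → b < c → ⊥
Above-¬312 (inj₁ (a<k , k≤b)) _ _ a≮b _ _ = a≮b (<-≤-trans a<k k≤b)
Above-¬312 _ _ (inj₁ (a<k , k≤c)) _ a≮c _ = a≮c (<-≤-trans a<k k≤c)
Above-¬312 _ (inj₂ (c<b , _)) _ _ _ b<c = <-asym c<b b<c
Above-¬312 (inj₂ (_ , inj₁ a<k)) (inj₁ (_ , k≤c)) (inj₂ (c<a , _)) _ _ _ = <-asym a<k (≤-<-trans k≤c c<a)
Above-¬312 (inj₂ (_ , inj₂ k≤b)) (inj₁ (b<k , _)) _ _ _ _ = <-irrefl refl (<-≤-trans b<k k≤b)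

Above⇒¬123-312 : ∀ k w → AllPairs (Above k) w → ¬ T (containsSome T123-312 w)
Above⇒¬123-312 k w layered h with containsSome⁻ T123-312 w h
... | _ , q , here refl , q⊆w , iso with orderIso-triple q iso
...   | a , b , c , refl with AllPairs-⊆ q⊆w layered | orderIso-123⁻ iso
...     | (ab ∷ _ ∷ []) ∷ (bc ∷ []) ∷ _ | a<b , b<c = Above-¬123 ab bc a<b b<c
Above⇒¬123-312 k w layered h | _ , q , there (here refl) , q⊆w , iso with orderIso-triple q iso
...   | a , b , c , refl with AllPairs-⊆ q⊆w layered | orderIso-312⁻ iso
...     | (ab ∷ ac ∷ []) ∷ (bc ∷ []) ∷ _ | a≮b , a≮c , b<c = Above-¬312 ab bc ac a≮b a≮c b<c

Outside-Above : ∀ {k x t u} → Outside k x t → Above k t u → Outside k x u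
Outside-Above (inj₁ t<x) (inj₁ (_ , k≤u)) = inj₂ k≤u
Outside-Above (inj₁ t<x) (inj₂ (u<t , _)) = inj₁ (<-trans u<t t<x)
Outside-Above (inj₂ k≤t) (inj₁ (t<k , _)) = ⊥-elim (<-irrefl refl (<-≤-trans t<k k≤t))
Outside-Above (inj₂ k≤t) (inj₂ (_ , inj₁ t<k)) = ⊥-elim (<-irrefl refl (<-≤-trans t<k k≤t))
Outside-Above (inj₂ k≤t) (inj₂ (_ , inj₂ k≤u)) = inj₂ k≤u

Outside⇒Above : ∀ {k x u} → x < k → Outside k x u → Above k x u
Outside⇒Above x<k (inj₁ u<x) = inj₂ (u<x , inj₁ x<k)
Outside⇒Above x<k (inj₂ k≤u) = inj₁ (x<k , k≤u)

Above-big : ∀ {k t u} → k ≤ t → Above k t u → k ≤ u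
Above-big k≤t (inj₁ (_ , k≤u)) = k≤u
Above-big k≤t (inj₂ (_ , inj₁ t<k)) = ⊥-elim (<-irrefl refl (<-≤-trans t<k k≤t))
Above-big k≤t (inj₂ (_ , inj₂ k≤u)) = k≤u

∈-below : ∀ {k t s} → k ∈ t ∷ s → t < k → k ∈ s
∈-below (here refl) t<k = ⊥-elim (<-irrefl refl t<k)
∈-below (there k∈s) _ = k∈s

-- A small x pops exactly the entries between x and k: each such t gives the occurrence x t k of 123.
pushSmall : ∀ k x s o → AllPairs (Above k) s → k ∈ s → x < k → x ∉ s →
  Push T123-312 x s o (λ t → x < t × t < k) (Outside k x)
pushSmall k x (t ∷ s) o (t↓ ∷ layered) k∈ x<k x∉ with t <? k
... | no t≮k = stop (inj₂ (≮⇒≥ t≮k))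
  where
  stop : Outside k x t → Push T123-312 x (t ∷ s) o (λ t → x < t × t < k) (Outside k x)
  stop out = Push-stop (Above⇒¬123-312 k _ (All.map (Outside⇒Above x<k) outs ∷ t↓ ∷ layered)) outs
    where outs = out ∷ All.map (Outside-Above out) t↓
... | yes t<k with <-cmp x t
...   | tri≈ _ x≡t _ = ⊥-elim (x∉ (here x≡t))
...   | tri> _ _ t<x = Push-stop (Above⇒¬123-312 k _ (All.map (Outside⇒Above x<k) outs ∷ t↓ ∷ layered)) outs
  where outs = inj₁ t<x ∷ All.map (Outside-Above (inj₁ t<x)) t↓
...   | tri< x<t _ _ =
  Push-pop (containsSome⁺ T123-312 (x ∷ t ∷ s) {q = x ∷ t ∷ k ∷ []} (here refl) (refl ∷ refl ∷ from∈ (∈-below k∈ t<k))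
             (orderIso-123⁺ x<t t<k))
    (x<t , t<k) (pushSmall k x s (o ++ t ∷ []) layered (∈-below k∈ t<k) x<k (λ i → x∉ (there i)))

-- A big x pops every small entry t: x t k is an occurrence of 312.
pushBig : ∀ k x s o → AllPairs (Above k) s → k ∈ s → k < x → All (_< x) s →
  Push T123-312 x s o (_< k) (k ≤_)
pushBig k x (t ∷ s) o (t↓ ∷ layered) k∈ k<x (t<x ∷ s<x) with t <? k
... | yes t<k =
  Push-pop (containsSome⁺ T123-312 (x ∷ t ∷ s) {q = x ∷ t ∷ k ∷ []} (there (here refl)) (refl ∷ refl ∷ from∈ (∈-below k∈ t<k))
             (orderIso-312⁺ (<-trans t<k k<x) k<x t<k))
    t<k (pushBig k x s (o ++ t ∷ []) layered (∈-below k∈ t<k) k<x s<x)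
... | no t≮k = Push-stop (Above⇒¬123-312 k _ (x↓ ∷ t↓ ∷ layered)) bigs
  where
  bigs : All (k ≤_) (t ∷ s)
  bigs = ≮⇒≥ t≮k ∷ All.map (Above-big (≮⇒≥ t≮k)) t↓
  x↓ : All (Above k x) (t ∷ s)
  x↓ = All.zipWith (λ (u<x , k≤u) → inj₂ (u<x , inj₂ k≤u)) ((t<x ∷ s<x) , bigs)

-- The patterns 31|2 and b21b3 of α(kρ) read back in ρ (α sends a value v < k to its position in ρ).
Occ31|2 : ℕ → List ℕ → Set
Occ31|2 k ρ = ∃₂ λ A B → ∃₂ λ C b →
  A < B × B < C × C < k × k < b × (B ∷ b ∷ C ∷ []) ⊆ ρ × (C ∷ A ∷ []) ⊆ ρ

Occb21b3 : ℕ → List ℕ → Set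
Occb21b3 k ρ = ∃₂ λ A B → ∃ λ C → ∃₂ λ D R → ρ ≡ D ++ A ∷ C ∷ R × B ∈ D × A < B × B < C × C < k

module Run123-312 (k : ℕ) (ρ : List ℕ) (u : Unique (k ∷ ρ)) (av : Avoids[132 (k ∷ ρ)) where

  uρ : Unique ρ
  uρ = AllPairs.tail u

  ρ≢k : ∀ {a} → a ∈ ρ → a ≢ k
  ρ≢k a∈ρ refl = Unique[x∷xs]⇒x∉xs u a∈ρ

  ∈-mid : ∀ {D x R} → ρ ≡ D ++ x ∷ R → x ∈ ρ
  ∈-mid {D} refl = ∈-++⁺ʳ D (here refl)

  record StackInv (D R : List ℕ) (st : State) : Set where
    field
      processed : Processed (k ∷ D) st
      layered : AllPairs (Above k) (proj₁ st)
      k∈stack : k ∈ proj₁ st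
      output<k : ∀ {a} → a ∈ proj₂ st → a < k

  record PushStep (x : ℕ) (s o : List ℕ) : Set where
    field
      popped kept : List ℕ
      split : s ≡ popped ++ kept
      result : pushGreedy T123-312 x s o ≡ (x ∷ kept , o ++ popped)
      popped<k : All (_< k) popped
      small : x < k → All (x <_) popped × All (Outside k x) kept
      big : k < x → All (k ≤_) kept
      layered′ : AllPairs (Above k) (x ∷ kept)
      k∈kept : k ∈ kept

  -- If x < t, then k t x is an occurrence of [132.
  earlier<big : ∀ {D x R t} → ρ ≡ D ++ x ∷ R → t ∈ D → k < x → t < x
  earlier<big {D} refl t∈D k<x with <-cmp _ _
  ... | tri< t<x _ _ = t<x
  ... | tri≈ _ t≡x _ = ⊥-elim (Unique-++-disjoint D uρ t∈D (here refl) t≡x)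
  ... | tri> _ _ x<t = ⊥-elim (av _ _ (pair⊆-++⁺ t∈D (here refl)) (k<x , x<t))

  stack<big : ∀ {D x R s o} → ρ ≡ D ++ x ∷ R → StackInv D (x ∷ R) (s , o) → k < x → ∀ {t} → t ∈ s → t < x
  stack<big eq inv k<x t∈s with proj₁ (StackInv.processed inv) _ t∈s
  ... | here refl = k<x
  ... | there t∈D = earlier<big eq t∈D k<x

  layered-suffix : ∀ {s hi lo} → AllPairs (Above k) s → s ≡ hi ++ lo → AllPairs (Above k) lo
  layered-suffix {hi = hi} layered refl = AllPairs-⊆ (Sublist.++⁺ˡ hi ⊆-refl) layered

  k∈suffix : ∀ {s hi lo} → k ∈ s → s ≡ hi ++ lo → All (_< k) hi → k ∈ lo
  k∈suffix {hi = hi} k∈s refl hi<k with ∈-++⁻ hi k∈s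
  ... | inj₁ k∈hi = ⊥-elim (<-irrefl refl (All.lookup hi<k k∈hi))
  ... | inj₂ k∈lo = k∈lo

  pushStep : ∀ D x R s o → ρ ≡ D ++ x ∷ R → StackInv D (x ∷ R) (s , o) → PushStep x s o
  pushStep D x R s o eq inv with <-cmp x k
  ... | tri≈ _ x≡k _ = ⊥-elim (ρ≢k (∈-mid eq) x≡k)
  ... | tri< x<k _ _ with pushSmall k x s o layered k∈stack x<k x∉s
    where
    open StackInv inv
    x∉s : x ∉ s
    x∉s x∈s with proj₁ processed x x∈s
    ... | here x≡k = ρ≢k (∈-mid eq) x≡k
    ... | there x∈D = Unique-mid-∉ D (subst Unique eq uρ) x∈D
  ... | pushed hi lo s≡ res ahi alo = record
    { popped = hi ; kept = lo ; split = s≡ ; result = res ; popped<k = All.map proj₂ ahi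
    ; small = λ _ → All.map proj₁ ahi , alo ; big = λ k<x → ⊥-elim (<-asym x<k k<x)
    ; layered′ = All.map (Outside⇒Above x<k) alo ∷ layered-suffix (StackInv.layered inv) s≡
    ; k∈kept = k∈suffix (StackInv.k∈stack inv) s≡ (All.map proj₂ ahi) }
  pushStep D x R s o eq inv | tri> _ _ k<x with pushBig k x s o layered k∈stack k<x (All.tabulate (stack<big eq inv k<x))
    where open StackInv inv
  ... | pushed hi lo s≡ res ahi alo = record
    { popped = hi ; kept = lo ; split = s≡ ; result = res ; popped<k = ahi
    ; small = λ x<k → ⊥-elim (<-asym x<k k<x) ; big = λ _ → alo
    ; layered′ = All.tabulate x-above ∷ layered-suffix (StackInv.layered inv) s≡
    ; k∈kept = k∈suffix (StackInv.k∈stack inv) s≡ ahi }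
    where
    x-above : ∀ {t} → t ∈ lo → Above k x t
    x-above t∈lo = inj₂ (stack<big eq inv k<x (subst (_ ∈_) (sym s≡) (∈-++⁺ʳ hi t∈lo)) , inj₂ (All.lookup alo t∈lo))

  StackInv-push : ∀ D x R st → ρ ≡ D ++ x ∷ R → StackInv D (x ∷ R) st →
    StackInv (D ++ [ x ]) R (pushGreedy T123-312 x (proj₁ st) (proj₂ st))
  StackInv-push D x R (s , o) eq inv = subst (StackInv (D ++ [ x ]) R) (sym result) record
    { processed = subst (Processed (k ∷ D ++ [ x ])) result (Processed-push T123-312 (k ∷ D) x s o processed)
    ; layered = layered′
    ; k∈stack = there k∈kept
    ; output<k = λ a∈ → [ output<k , All.lookup popped<k ]′ (∈-++⁻ o a∈)
    }
    where
    open StackInv inv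
    open PushStep (pushStep D x R s o eq inv)

  start : State
  start = k ∷ [] , []

  stateAfter : List ℕ → State
  stateAfter D = run T123-312 D start

  inv-after : ∀ D R → ρ ≡ D ++ R → StackInv D R (stateAfter D)
  inv-after = run-invariant T123-312 ρ StackInv StackInv-push start record
    { processed = (λ _ a∈ → a∈) , (λ _ a∈ → inj₂ a∈) ; layered = [] ∷ [] ; k∈stack = here refl ; output<k = λ () }

  stepAt : ∀ D x R → ρ ≡ D ++ x ∷ R → PushStep x (proj₁ (stateAfter D)) (proj₂ (stateAfter D))
  stepAt D x R eq = pushStep D x R _ _ eq (inv-after D (x ∷ R) eq)

  stateAfter-snoc : ∀ D x R (eq : ρ ≡ D ++ x ∷ R) → let open PushStep (stepAt D x R eq) in
    stateAfter (D ++ [ x ]) ≡ (x ∷ kept , proj₂ (stateAfter D) ++ popped)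
  stateAfter-snoc D x R eq = trans (run-++ T123-312 D [ x ] start) (PushStep.result (stepAt D x R eq))

  F : List ℕ
  F = flush (run T123-312 ρ start)

  TStack≡F : TStack T123-312 (k ∷ ρ) ≡ F
  TStack≡F = runStack≡flush∘run T123-312 ρ (k ∷ []) []

  F-after : ∀ D x R (eq : ρ ≡ D ++ x ∷ R) → let open PushStep (stepAt D x R eq) in
    F ≡ flush (run T123-312 R (x ∷ kept , proj₂ (stateAfter D) ++ popped))
  F-after D x R eq = begin
    flush (run T123-312 ρ start)                  ≡⟨ cong (λ w → flush (run T123-312 w start)) eq ⟩
    flush (run T123-312 (D ++ x ∷ R) start)       ≡⟨ cong flush (run-++ T123-312 D (x ∷ R) start) ⟩
    flush (run T123-312 (x ∷ R) (stateAfter D))   ≡⟨ cong (λ st → flush (run T123-312 R st)) result ⟩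
    flush (run T123-312 R (x ∷ kept , proj₂ (stateAfter D) ++ popped)) ∎
    where
    open ≡-Reasoning
    open PushStep (stepAt D x R eq)

  kept-outside : ∀ {D x R s o a} → ρ ≡ D ++ x ∷ R → (step : PushStep x s o) → a < k → (x < k → x < a) →
    a ∉ PushStep.kept step
  kept-outside {x = x} eq step a<k x<a a∈kept with <-cmp x k
  ... | tri< x<k _ _ with All.lookup (proj₂ (PushStep.small step x<k)) a∈kept
  ...   | inj₁ a<x = <-asym a<x (x<a x<k)
  ...   | inj₂ k≤a = <-irrefl refl (<-≤-trans a<k k≤a)
  kept-outside eq step a<k x<a a∈kept | tri≈ _ x≡k _ = ρ≢k (∈-mid eq) x≡k
  kept-outside eq step a<k x<a a∈kept | tri> _ _ k<x =
    <-irrefl refl (<-≤-trans a<k (All.lookup (PushStep.big step k<x) a∈kept))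

  precedes-after : ∀ D x R {a v} → ρ ≡ D ++ x ∷ R → a ∈ k ∷ D → a < k → (x < k → x < a) → v ∈ x ∷ R →
    (a ∷ v ∷ []) ⊆ F
  precedes-after D x R {a} {v} eq a∈ a<k x<a v∈ =
    subst ((a ∷ v ∷ []) ⊆_) (sym (F-after D x R eq))
      (output-before-pending T123-312 R (x ∷ kept) (proj₂ (stateAfter D) ++ popped) a∈out (later v∈))
    where
    inv = inv-after D (x ∷ R) eq
    open PushStep (stepAt D x R eq)
    a∈out : a ∈ proj₂ (stateAfter D) ++ popped
    a∈out with proj₂ (StackInv.processed inv) a a∈
    ... | inj₁ a∈o = ∈-++⁺ˡ a∈o
    ... | inj₂ a∈s with ∈-++⁻ popped (subst (a ∈_) split a∈s)
    ...   | inj₁ a∈p = ∈-++⁺ʳ _ a∈p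
    ...   | inj₂ a∈k = ⊥-elim (kept-outside eq (stepAt D x R eq) a<k x<a a∈k)
    later : ∀ {w} → w ∈ x ∷ R → w ∈ (x ∷ kept) ++ R
    later (here refl) = here refl
    later (there w∈R) = ∈-++⁺ʳ (x ∷ kept) w∈R

  split-around : ∀ {a w v} → (a ∷ w ∷ v ∷ []) ⊆ ρ → ∃₂ λ D R → ρ ≡ D ++ w ∷ R × a ∈ D × v ∈ R
  split-around {a} {w} sub with ∷⊆-split sub
  ... | P , _ , refl , sub′ with ∷⊆-split sub′
  ... | M , Q , refl , v⊆Q = P ++ a ∷ M , Q , sym (++-assoc P (a ∷ M) (w ∷ Q)) , ∈-++⁺ʳ P (here refl) , to∈ v⊆Q

  split-after : ∀ {a w} → (a ∷ w ∷ []) ⊆ ρ → ∃₂ λ D R → ρ ≡ D ++ w ∷ R × a ∈ D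
  split-after {a} {w} sub with pair⊆-split sub
  ... | P , M , Q , refl = P ++ a ∷ M , Q , sym (++-assoc P (a ∷ M) (w ∷ Q)) , ∈-++⁺ʳ P (here refl)

  big-between⇒before : ∀ {a b v} → (a ∷ b ∷ v ∷ []) ⊆ ρ → a < k → k < b → (a ∷ v ∷ []) ⊆ F
  big-between⇒before sub a<k k<b with split-around sub
  ... | D , R , eq , a∈D , v∈R = precedes-after D _ R eq (there a∈D) a<k (λ b<k → ⊥-elim (<-asym b<k k<b)) (there v∈R)

  smaller-between⇒before : ∀ {a w v} → (a ∷ w ∷ v ∷ []) ⊆ ρ → w < a → a < k → (a ∷ v ∷ []) ⊆ F
  smaller-between⇒before sub w<a a<k with split-around sub
  ... | D , R , eq , a∈D , v∈R = precedes-after D _ R eq (there a∈D) a<k (λ _ → w<a) (there v∈R)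

  decreasing⇒before : ∀ {a v} → (a ∷ v ∷ []) ⊆ ρ → v < a → a < k → (a ∷ v ∷ []) ⊆ F
  decreasing⇒before sub v<a a<k with split-after sub
  ... | D , R , eq , a∈D = precedes-after D _ R eq (there a∈D) a<k (λ _ → v<a) (here refl)

  stays-on-stack : ∀ D M R {a} → ρ ≡ D ++ M ++ R → a ∈ proj₁ (stateAfter D) → All (λ m → a < m × m < k) M →
    a ∈ proj₁ (stateAfter (D ++ M))
  stays-on-stack D [] R eq a∈ [] = subst (λ z → _ ∈ proj₁ (stateAfter z)) (sym (++-identityʳ D)) a∈
  stays-on-stack D (m ∷ M) R {a} eq a∈ ((a<m , m<k) ∷ M↑) =
    subst (λ z → a ∈ proj₁ (stateAfter z)) (++-assoc D [ m ] M)
      (stays-on-stack (D ++ [ m ]) M R (trans eq (sym (++-assoc D [ m ] (M ++ R)))) a∈′ M↑)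
    where
    open PushStep (stepAt D m (M ++ R) eq)
    a∈′ : a ∈ proj₁ (stateAfter (D ++ [ m ]))
    a∈′ with ∈-++⁻ popped (subst (a ∈_) split a∈)
    ... | inj₁ a∈p = ⊥-elim (<-asym a<m (All.lookup (proj₁ (small m<k)) a∈p))
    ... | inj₂ a∈k = subst (λ st → a ∈ proj₁ st) (sym (stateAfter-snoc D m (M ++ R) eq)) (there a∈k)

  -- a stays on the stack while the entries between a and k are read, so v is pushed on top of it.
  gap⇒reversed : ∀ D M R {a v} → ρ ≡ D ++ a ∷ M ++ v ∷ R → All (λ m → a < m × m < k) M → a < v → v < k →
    (v ∷ a ∷ []) ⊆ F
  gap⇒reversed D M R {a} {v} eq M↑ a<v v<k =
    subst ((v ∷ a ∷ []) ⊆_) (sym (F-after D′ v R eq′))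
      (stack-order-kept T123-312 R (v ∷ kept) (proj₂ (stateAfter D′) ++ popped) (refl ∷ from∈ a∈kept))
    where
    D′ = D ++ a ∷ M
    eq′ : ρ ≡ D′ ++ v ∷ R
    eq′ = trans eq (sym (++-assoc D (a ∷ M) (v ∷ R)))
    a-pushed : a ∈ proj₁ (stateAfter (D ++ [ a ]))
    a-pushed = subst (λ st → a ∈ proj₁ st) (sym (stateAfter-snoc D a (M ++ v ∷ R) eq)) (here refl)
    a-kept : a ∈ proj₁ (stateAfter D′)
    a-kept = subst (λ z → a ∈ proj₁ (stateAfter z)) (++-assoc D [ a ] M)
      (stays-on-stack (D ++ [ a ]) M (v ∷ R) (trans eq (sym (++-assoc D [ a ] (M ++ v ∷ R)))) a-pushed M↑)
    open PushStep (stepAt D′ v R eq′)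
    a∈kept : a ∈ kept
    a∈kept with ∈-++⁻ popped (subst (a ∈_) split a-kept)
    ... | inj₁ a∈p = ⊥-elim (<-asym a<v (All.lookup (proj₁ (small v<k)) a∈p))
    ... | inj₂ a∈k = a∈k

  F↭kρ : F ↭ k ∷ ρ
  F↭kρ with flush-run-↭ T123-312 ρ (k ∷ []) []
  ... | X , eq , X↭ = subst (_↭ k ∷ ρ) (sym eq) X↭

  uF : Unique F
  uF = Unique-resp-↭ (↭-sym F↭kρ) u

  F-small∈ρ : ∀ {a} → a ∈ F → a < k → a ∈ ρ
  F-small∈ρ a∈F a<k with ∈-resp-↭ F↭kρ a∈F
  ... | here refl = ⊥-elim (<-irrefl refl a<k)
  ... | there a∈ρ = a∈ρ

  module Final = StackInv (inv-after ρ [] (sym (++-identityʳ ρ)))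

  big∈stack : ∀ {b} → b ∈ F → k ≤ b → b ∈ proj₁ (stateAfter ρ)
  big∈stack b∈F k≤b with ∈-++⁻ (proj₂ (stateAfter ρ)) b∈F
  ... | inj₁ b∈o = ⊥-elim (<-irrefl refl (<-≤-trans (Final.output<k b∈o) k≤b))
  ... | inj₂ b∈s = b∈s

  small-before-big : ∀ {a b} → a ∈ F → b ∈ F → a < k → k ≤ b → (a ∷ b ∷ []) ⊆ F
  small-before-big a∈F b∈F a<k k≤b with ∈-++⁻ (proj₂ (stateAfter ρ)) a∈F
  ... | inj₁ a∈o = pair⊆-++⁺ a∈o (big∈stack b∈F k≤b)
  ... | inj₂ a∈s with pair⊆-total a∈s (big∈stack b∈F k≤b) (λ a≡b → <-irrefl a≡b (<-≤-trans a<k k≤b))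
  ...   | inj₁ ab = Sublist.++⁺ˡ _ ab
  ...   | inj₂ ba with AllPairs-pair⊆ Final.layered ba
  ...     | inj₁ (b<k , _) = ⊥-elim (<-irrefl refl (<-≤-trans b<k k≤b))
  ...     | inj₂ (_ , inj₁ b<k) = ⊥-elim (<-irrefl refl (<-≤-trans b<k k≤b))
  ...     | inj₂ (_ , inj₂ k≤a) = ⊥-elim (<-irrefl refl (<-≤-trans a<k k≤a))

  big-decreasing : ∀ {a b} → a ∈ F → b ∈ F → k ≤ b → b < a → (a ∷ b ∷ []) ⊆ F
  big-decreasing a∈F b∈F k≤b b<a
    with pair⊆-total (big∈stack a∈F (≤-trans k≤b (<⇒≤ b<a))) (big∈stack b∈F k≤b) (λ a≡b → <-irrefl (sym a≡b) b<a)
  ... | inj₁ ab = Sublist.++⁺ˡ _ ab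
  ... | inj₂ ba with AllPairs-pair⊆ Final.layered ba
  ...   | inj₁ (b<k , _) = ⊥-elim (<-irrefl refl (<-≤-trans b<k k≤b))
  ...   | inj₂ (a<b , _) = ⊥-elim (<-asym a<b b<a)

  ∉-after : ∀ {D a R} → ρ ≡ D ++ a ∷ R → a ∉ R
  ∉-after {D} eq = Unique[x∷xs]⇒x∉xs (AllPairs-⊆ (Sublist.++⁺ˡ D ⊆-refl) (subst Unique eq uρ))

  ends⊆ : ∀ {D a M v R} → ρ ≡ D ++ a ∷ M ++ v ∷ R → (a ∷ v ∷ []) ⊆ ρ
  ends⊆ {D} {M = M} eq = subst (_ ⊆_) (sym eq) (Sublist.++⁺ˡ D (refl ∷ Sublist.++⁺ˡ M (refl ∷ minimum _)))

  mid⊆ : ∀ {D a M v R m} → ρ ≡ D ++ a ∷ M ++ v ∷ R → m ∈ M → (a ∷ m ∷ v ∷ []) ⊆ ρ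
  mid⊆ {D} eq m∈M = subst (_ ⊆_) (sym eq) (Sublist.++⁺ˡ D (refl ∷ Sublist.++⁺ (from∈ m∈M) (refl ∷ minimum _)))

  reversed⇒gap : ∀ D M R {a v} → ρ ≡ D ++ a ∷ M ++ v ∷ R → a < k → (v ∷ a ∷ []) ⊆ F →
    a < v × All (λ m → a < m × m < k) M
  reversed⇒gap D M R {a} {v} eq a<k va⊆F = a<v , All.tabulate between
    where
    not-before : (a ∷ v ∷ []) ⊆ F → ⊥
    not-before av⊆F = Unique-pair⊆-antisym uF av⊆F va⊆F
    a<v : a < v
    a<v with <-cmp a v
    ... | tri< a<v _ _ = a<v
    ... | tri≈ _ a≡v _ = ⊥-elim (∉-after eq (∈-++⁺ʳ M (here a≡v)))
    ... | tri> _ _ v<a = ⊥-elim (not-before (decreasing⇒before (ends⊆ eq) v<a a<k))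
    between : ∀ {m} → m ∈ M → a < m × m < k
    between {m} m∈M with <-cmp a m | <-cmp m k
    ... | tri< a<m _ _ | tri< m<k _ _ = a<m , m<k
    ... | _ | tri≈ _ m≡k _ = ⊥-elim (ρ≢k (to∈ (Sublist.∷ˡ⁻ (mid⊆ eq m∈M))) m≡k)
    ... | _ | tri> _ _ k<m = ⊥-elim (not-before (big-between⇒before (mid⊆ eq m∈M) a<k k<m))
    ... | tri≈ _ a≡m _ | _ = ⊥-elim (∉-after eq (∈-++⁺ˡ (subst (_∈ M) (sym a≡m) m∈M)))
    ... | tri> _ _ m<a | _ = ⊥-elim (not-before (smaller-between⇒before (mid⊆ eq m∈M) m<a a<k))

  Occ31|2⇒¬avoids231 : Occ31|2 k ρ → ¬ Avoids231 F
  Occ31|2⇒¬avoids231 (A , B , C , b , A<B , B<C , C<k , k<b , BbC , CA) av =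
    av B C A (Unique-pair⊆-join uF (big-between⇒before BbC (<-trans B<C C<k) k<b)
                                   (decreasing⇒before CA (<-trans A<B B<C) C<k)) A<B B<C

  Occb21b3⇒¬avoids231 : Occb21b3 k ρ → ¬ Avoids231 F
  Occb21b3⇒¬avoids231 (A , B , C , D , R , eq , B∈D , A<B , B<C , C<k) av =
    av B C A (Unique-pair⊆-join uF (smaller-between⇒before BAC A<B (<-trans B<C C<k))
                                   (gap⇒reversed D [] R eq [] (<-trans A<B B<C) C<k)) A<B B<C
    where
    BAC : (B ∷ A ∷ C ∷ []) ⊆ ρ
    BAC = subst (_ ⊆_) (sym eq) (Sublist.++⁺ (from∈ B∈D) (refl ∷ refl ∷ minimum R))

  straddle⇒Occb21b3 : ∀ D s₀ N y R {B} → ρ ≡ D ++ s₀ ∷ N ++ y ∷ R → B ∈ D → s₀ < B → B < y →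
    All (_< k) N → y < k → Occb21b3 k ρ
  straddle⇒Occb21b3 D s₀ N y R {B} eq B∈D s₀<B B<y N<k y<k
    with adjacent-straddle B s₀ N y s₀<B B<y (All.tabulate N≢B) N<k y<k
    where
    N≢B : ∀ {m} → m ∈ N → m ≢ B
    N≢B m∈N m≡B = Unique-++-disjoint D (subst Unique eq uρ) B∈D (there (∈-++⁺ˡ m∈N)) (sym m≡B)
  ... | S₁ , S₂ , A , C , split , A<B , B<C , C<k =
    A , B , C , D ++ S₁ , S₂ ++ R , eq′ , ∈-++⁺ˡ B∈D , A<B , B<C , C<k
    where
    open ≡-Reasoning
    eq′ : ρ ≡ (D ++ S₁) ++ A ∷ C ∷ S₂ ++ R
    eq′ = begin
      ρ                               ≡⟨ eq ⟩
      D ++ s₀ ∷ N ++ y ∷ R            ≡⟨ cong (λ z → D ++ s₀ ∷ z) (sym (++-assoc N [ y ] R)) ⟩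
      D ++ (s₀ ∷ N ++ [ y ]) ++ R     ≡⟨ cong (λ z → D ++ z ++ R) split ⟩
      D ++ (S₁ ++ A ∷ C ∷ S₂) ++ R    ≡⟨ cong (D ++_) (++-assoc S₁ (A ∷ C ∷ S₂) R) ⟩
      D ++ S₁ ++ A ∷ C ∷ S₂ ++ R      ≡⟨ sym (++-assoc D S₁ _) ⟩
      (D ++ S₁) ++ A ∷ C ∷ S₂ ++ R    ∎

  -- X precedes Y in F although all entries between them in ρ are small: some entry m < X lies
  -- between them (otherwise gap⇒reversed), and X, m, Y yield the witness.
  small-gap⇒Occb21b3 : ∀ D N R {X Y} → ρ ≡ D ++ X ∷ N ++ Y ∷ R → All (_< k) N → X < Y → Y < k →
    (X ∷ Y ∷ []) ⊆ F → Occb21b3 k ρ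
  small-gap⇒Occb21b3 D N R {X} {Y} eq N<k X<Y Y<k XY⊆F with all-or-counterexample (X <?_) N
  ... | inj₁ X<N = ⊥-elim (Unique-pair⊆-antisym uF XY⊆F
                     (gap⇒reversed D N R eq (All.zipWith (λ p → p) (X<N , N<k)) X<Y Y<k))
  ... | inj₂ (m , m∈N , X≮m) with ∈-∃++ m∈N
  ...   | N₁ , N₂ , refl =
    straddle⇒Occb21b3 (D ++ X ∷ N₁) m N₂ Y R eq′ (∈-++⁺ʳ D (here refl)) m<X X<Y
      (All.tabulate λ i → All.lookup N<k (∈-++⁺ʳ N₁ (there i))) Y<k
    where
    eq′ : ρ ≡ (D ++ X ∷ N₁) ++ m ∷ N₂ ++ Y ∷ R
    eq′ = trans eq (trans (cong (λ z → D ++ X ∷ z) (++-assoc N₁ (m ∷ N₂) (Y ∷ R)))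
                          (sym (++-assoc D (X ∷ N₁) (m ∷ N₂ ++ Y ∷ R))))
    m<X : m < X
    m<X = ≤∧≢⇒< (≮⇒≥ X≮m) (λ m≡X → ∉-after eq (∈-++⁺ˡ (subst (_∈ N₁ ++ m ∷ N₂) m≡X m∈N)))

  middle<k : ∀ {X Y Z} → (X ∷ Y ∷ Z ∷ []) ⊆ F → Z < X → X < Y → Y < k
  middle<k {X} {Y} {Z} XYZ Z<X X<Y with Y <? k | X <? k
  ... | yes Y<k | _ = Y<k
  ... | no Y≮k | no X≮k =
    ⊥-elim (Unique-pair⊆-antisym uF (triple⊆⇒₁₂ XYZ) (big-decreasing Y∈F X∈F (≮⇒≥ X≮k) X<Y))
    where X∈F = to∈ XYZ
          Y∈F = to∈ (triple⊆⇒₂₃ XYZ)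
  ... | no Y≮k | yes X<k =
    ⊥-elim (Unique-pair⊆-antisym uF (triple⊆⇒₂₃ XYZ) (small-before-big Z∈F Y∈F (<-trans Z<X X<k) (≮⇒≥ Y≮k)))
    where Y∈F = to∈ (triple⊆⇒₂₃ XYZ)
          Z∈F = to∈ (Sublist.∷ˡ⁻ (triple⊆⇒₂₃ XYZ))

  Z-first⇒Occb21b3 : ∀ {X Y Z} → (Z ∷ Y ∷ []) ⊆ ρ → (X ∷ Y ∷ []) ⊆ ρ → Z < X → X < Y → Y < k →
    (X ∷ Y ∷ Z ∷ []) ⊆ F → Occb21b3 k ρ
  Z-first⇒Occb21b3 {X} {Y} {Z} ZYρ XYρ Z<X X<Y Y<k XYZ with pair⊆-split ZYρ
  ... | D , M , R , eq with reversed⇒gap D M R eq (<-trans Z<X (<-trans X<Y Y<k)) (triple⊆⇒₂₃ XYZ)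
  ... | _ , M↑ with ∈-++⁻ D (subst (X ∈_) eq (to∈ XYρ))
  ...   | inj₁ X∈D = straddle⇒Occb21b3 D Z M Y R eq X∈D Z<X X<Y (All.map proj₂ M↑) Y<k
  ...   | inj₂ (here X≡Z) = ⊥-elim (<-irrefl (sym X≡Z) Z<X)
  ...   | inj₂ (there X∈) with ∈-++⁻ M X∈
  ...     | inj₂ (here X≡Y) = ⊥-elim (<-irrefl X≡Y X<Y)
  ...     | inj₂ (there X∈R) = ⊥-elim (Unique-pair⊆-antisym uρ XYρ
            (subst (_ ⊆_) (sym eq) (Sublist.++⁺ˡ D (Z ∷ʳ Sublist.++⁺ˡ M (refl ∷ from∈ X∈R)))))
  ...     | inj₁ X∈M with ∈-∃++ X∈M
  ...       | M₁ , M₂ , refl =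
    small-gap⇒Occb21b3 (D ++ Z ∷ M₁) M₂ R
      (trans eq (trans (cong (λ z → D ++ Z ∷ z) (++-assoc M₁ (X ∷ M₂) (Y ∷ R)))
                       (sym (++-assoc D (Z ∷ M₁) (X ∷ M₂ ++ Y ∷ R)))))
      (All.tabulate λ i → proj₂ (All.lookup M↑ (∈-++⁺ʳ M₁ (there i)))) X<Y Y<k (triple⊆⇒₁₂ XYZ)

  small-231⇒Occ : ∀ {X Y Z} → (X ∷ Y ∷ Z ∷ []) ⊆ F → Z < X → X < Y → Y < k → Occ31|2 k ρ ⊎ Occb21b3 k ρ
  small-231⇒Occ {X} {Y} {Z} XYZ Z<X X<Y Y<k
    with pair⊆-total Xρ Yρ (<⇒≢ X<Y) | pair⊆-total Yρ Zρ (λ Y≡Z → <-irrefl (sym Y≡Z) (<-trans Z<X X<Y))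
    where
    Xρ = F-small∈ρ (to∈ XYZ) (<-trans X<Y Y<k)
    Yρ = F-small∈ρ (to∈ (triple⊆⇒₂₃ XYZ)) Y<k
    Zρ = F-small∈ρ (to∈ (Sublist.∷ˡ⁻ (triple⊆⇒₂₃ XYZ))) (<-trans Z<X (<-trans X<Y Y<k))
  ... | inj₂ YXρ | _ = ⊥-elim (Unique-pair⊆-antisym uF (triple⊆⇒₁₂ XYZ) (decreasing⇒before YXρ X<Y Y<k))
  ... | inj₁ XYρ | inj₂ ZYρ = inj₂ (Z-first⇒Occb21b3 ZYρ XYρ Z<X X<Y Y<k XYZ)
  ... | inj₁ XYρ | inj₁ YZρ with pair⊆-split XYρ
  ...   | D , M , R , eq with all-or-counterexample (_<? k) M
  ...     | inj₁ M<k = inj₂ (small-gap⇒Occb21b3 D M R eq M<k X<Y Y<k (triple⊆⇒₁₂ XYZ))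
  ...     | inj₂ (b , b∈M , b≮k) = inj₁ (Z , X , Y , b , Z<X , X<Y , Y<k , k<b , mid⊆ eq b∈M , YZρ)
    where
    k<b : k < b
    k<b = ≤∧≢⇒< (≮⇒≥ b≮k) (λ k≡b → ρ≢k (to∈ (Sublist.∷ˡ⁻ (mid⊆ eq b∈M))) (sym k≡b))

  Occ-free⇒avoids231 : ¬ Occ31|2 k ρ → ¬ Occb21b3 k ρ → Avoids231 F
  Occ-free⇒avoids231 no31|2 nob21b3 X Y Z XYZ Z<X X<Y =
    [ no31|2 , nob21b3 ]′ (small-231⇒Occ XYZ Z<X X<Y (middle<k XYZ Z<X X<Y))

  sortable⇔avoids231 : ∀ n → k ∷ ρ ↭ range n → Sortable T123-312 n (k ∷ ρ) ⇔ Avoids231 F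
  sortable⇔avoids231 n perm = mk⇔
    (λ sorts → classicalStack-sorts⇒avoids231 F n uF (trans (cong (TStack T21) (sym TStack≡F)) sorts))
    (λ avoids → trans (cong (TStack T21) TStack≡F) (avoids231⇒classicalStack-sorts F n uF (↭-trans F↭kρ perm) avoids))

  avoids231⇔¬Occ : Avoids231 F ⇔ (¬ Occ31|2 k ρ × ¬ Occb21b3 k ρ)
  avoids231⇔¬Occ = mk⇔
    (λ avoids → (λ occ → Occ31|2⇒¬avoids231 occ avoids) , (λ occ → Occb21b3⇒¬avoids231 occ avoids))
    (λ (no31|2 , nob21b3) → Occ-free⇒avoids231 no31|2 nob21b3)

-- Positions and α

pos-head : ∀ a ys → pos a (a ∷ ys) ≡ 1
pos-head a ys rewrite Equivalence.to T-≡ (≡⇒≡ᵇ a a refl) = refl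

pos-tail : ∀ {a y} ys → a ≢ y → pos a (y ∷ ys) ≡ suc (pos a ys)
pos-tail {a} {y} ys a≢y with a ≡ᵇ y in eq
... | true = ⊥-elim (a≢y (≡ᵇ⇒≡ a y (subst T (sym eq) tt)))
... | false = refl

pos-++ : ∀ {b} P R → b ∉ P → pos b (P ++ R) ≡ length P + pos b R
pos-++ [] R _ = refl
pos-++ (p ∷ P) R b∉ = trans (pos-tail (P ++ R) (λ b≡p → b∉ (here b≡p))) (cong suc (pos-++ P R (λ i → b∉ (there i))))

pos-surjective : ∀ w → Unique w → ∀ m → 0 < m → m ≤ length w → ∃ λ b → b ∈ w × pos b w ≡ m
pos-surjective (x ∷ w) _ 1 _ _ = x , here refl , pos-head x w
pos-surjective (x ∷ w) (x∉ ∷ u) (suc (suc m)) _ (s≤s m<) with pos-surjective w u (suc m) (s≤s z≤n) m<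
... | b , b∈w , eq = b , there b∈w , trans (pos-tail w (λ b≡x → All.lookup x∉ b∈w (sym b≡x))) (cong suc eq)

pos-≤-length : ∀ {b w} → b ∈ w → pos b w ≤ length w
pos-≤-length {b} (here {xs = w} refl) rewrite pos-head b w = s≤s z≤n
pos-≤-length {b} {y ∷ w} (there b∈w) with b ≡ᵇ y
... | true = s≤s z≤n
... | false = s≤s (pos-≤-length b∈w)

∷-split-≡ : ∀ (P P′ : List ℕ) {a c R Q} → P ++ a ∷ R ≡ P′ ++ c ∷ Q → length P′ ≡ suc (length P) → R ≡ c ∷ Q
∷-split-≡ [] (_ ∷ []) eq refl = ∷-injectiveʳ eq
∷-split-≡ (_ ∷ P) (_ ∷ P′) eq len = ∷-split-≡ P P′ (∷-injectiveʳ eq) (suc-injective len)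

module Positions (w : List ℕ) (uw : Unique w) where

  pos-split : ∀ {P a R} → w ≡ P ++ a ∷ R → pos a w ≡ suc (length P)
  pos-split {P} {a} {R} refl = begin
    pos a (P ++ a ∷ R)      ≡⟨ pos-++ P (a ∷ R) (Unique-mid-∉ P uw) ⟩
    length P + pos a (a ∷ R) ≡⟨ cong (length P +_) (pos-head a R) ⟩
    length P + 1            ≡⟨ +-comm (length P) 1 ⟩
    suc (length P)          ∎
    where open ≡-Reasoning

  pos-mono : ∀ {a b} → (a ∷ b ∷ []) ⊆ w → pos a w < pos b w
  pos-mono {a} sub with pair⊆-split sub
  ... | P , M , Q , eq rewrite pos-split eq | pos-split (trans eq (sym (++-assoc P (a ∷ M) (_ ∷ Q)))) | length-++ P {a ∷ M} =
    s≤s (m<m+n (length P) z<s)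

  pos-mono⁻ : ∀ {a b} → a ∈ w → b ∈ w → pos a w < pos b w → (a ∷ b ∷ []) ⊆ w
  pos-mono⁻ a∈ b∈ lt with pair⊆-total a∈ b∈ (λ a≡b → <-irrefl (cong (λ z → pos z w) a≡b) lt)
  ... | inj₁ ab = ab
  ... | inj₂ ba = ⊥-elim (<-asym lt (pos-mono ba))

  pos-injective : ∀ {a b} → a ∈ w → b ∈ w → pos a w ≡ pos b w → a ≡ b
  pos-injective {a} {b} a∈ b∈ eq with a ≟ b
  ... | yes a≡b = a≡b
  ... | no a≢b with pair⊆-total a∈ b∈ a≢b
  ...   | inj₁ ab = ⊥-elim (<-irrefl eq (pos-mono ab))
  ...   | inj₂ ba = ⊥-elim (<-irrefl (sym eq) (pos-mono ba))

  pos-before : ∀ {P a R b} → w ≡ P ++ a ∷ R → b ∈ w → pos b w < pos a w → b ∈ P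
  pos-before {P} {a} {R} eq b∈ lt with ∈-++⁻ P (subst (_ ∈_) eq b∈)
  ... | inj₁ b∈P = b∈P
  ... | inj₂ (here refl) = ⊥-elim (<-irrefl refl lt)
  ... | inj₂ (there b∈R) = ⊥-elim (<-asym lt (pos-mono (subst (_ ⊆_) (sym eq) (Sublist.++⁺ˡ P (refl ∷ from∈ b∈R)))))

  pos-adjacent : ∀ {a c} → a ∈ w → c ∈ w → pos c w ≡ suc (pos a w) → ∃₂ λ P Q → w ≡ P ++ a ∷ c ∷ Q
  pos-adjacent a∈ c∈ eq with ∈-∃++ a∈ | ∈-∃++ c∈
  ... | P , R , eqa | P′ , Q , eqc =
    P , Q , trans eqa (cong (λ z → P ++ _ ∷ z) (∷-split-≡ P P′ (trans (sym eqa) eqc)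
      (suc-injective (trans (sym (pos-split eqc)) (trans eq (cong suc (pos-split eqa)))))))
⊆-map⁻ : ∀ (f : ℕ → ℕ) {xs} L → xs ⊆ map f L → ∃ λ ys → ys ⊆ L × xs ≡ map f ys
⊆-map⁻ f [] [] = [] , [] , refl
⊆-map⁻ f (l ∷ L) (_ ∷ʳ p) with ⊆-map⁻ f L p
... | ys , q , eq = ys , l ∷ʳ q , eq
⊆-map⁻ f (l ∷ L) (refl ∷ p) with ⊆-map⁻ f L p
... | ys , q , eq = l ∷ ys , refl ∷ q , cong (f l ∷_) eq

triple⊆-map⁻ : ∀ (f : ℕ → ℕ) {x y z} L → (x ∷ y ∷ z ∷ []) ⊆ map f L →
  ∃₂ λ a b → ∃ λ c → (a ∷ b ∷ c ∷ []) ⊆ L × x ≡ f a × y ≡ f b × z ≡ f c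
triple⊆-map⁻ f L p with ⊆-map⁻ f L p
... | a ∷ b ∷ c ∷ [] , q , refl = a , b , c , q , refl , refl , refl

<⇒≤∸1 : ∀ {v k} → v < k → v ≤ k ∸ 1
<⇒≤∸1 {k = suc k} (s≤s v≤k) = v≤k

≤∸1⇒< : ∀ {v k} → 0 < v → v ≤ k ∸ 1 → v < k
≤∸1⇒< {k = suc k} _ v≤k = s≤s v≤k
≤∸1⇒< {suc v} {zero} _ ()

perm⇒positive : ∀ {n k ρ a} → k ∷ ρ ↭ range n → a ∈ ρ → 0 < a
perm⇒positive perm a∈ρ = proj₁ (∈-range⁻ (∈-resp-↭ perm (there a∈ρ)))

perm⇒small∈ρ : ∀ {n k ρ v} → k ∷ ρ ↭ range n → 0 < v → v < k → v ∈ ρ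
perm⇒small∈ρ perm 0<v v<k
  with ∈-resp-↭ (↭-sym perm) (∈-range⁺ 0<v (≤-trans (<⇒≤ v<k) (proj₂ (∈-range⁻ (∈-resp-↭ perm (here refl))))))
... | here v≡k = ⊥-elim (<-irrefl v≡k v<k)
... | there v∈ρ = v∈ρ

module Alpha (k : ℕ) (ρ : List ℕ) (uρ : Unique ρ) (ρ≢k : ∀ {a} → a ∈ ρ → a ≢ k)
             (ρ-positive : ∀ {a} → a ∈ ρ → 0 < a) (small∈ρ : ∀ {v} → 0 < v → v < k → v ∈ ρ) where

  open Positions ρ uρ

  smalls : List ℕ
  smalls = range (k ∸ 1)

  αρ : List ℕ
  αρ = map (λ v → pos v ρ) smalls

  ∈-smalls⁻ : ∀ {v} → v ∈ smalls → 0 < v × v < k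
  ∈-smalls⁻ v∈ with ∈-range⁻ v∈
  ... | 0<v , v≤ = 0<v , ≤∸1⇒< 0<v v≤

  ∈-smalls⁺ : ∀ {v} → v ∈ ρ → v < k → v ∈ smalls
  ∈-smalls⁺ v∈ρ v<k = ∈-range⁺ (ρ-positive v∈ρ) (<⇒≤∸1 v<k)

  smalls⇒ρ : ∀ {v} → v ∈ smalls → v ∈ ρ
  smalls⇒ρ v∈ = small∈ρ (proj₁ (∈-smalls⁻ v∈)) (proj₂ (∈-smalls⁻ v∈))

  increasing⇒⊆smalls : ∀ {A B C} → A ∈ ρ → B ∈ ρ → C ∈ ρ → A < B → B < C → C < k →
    (A ∷ B ∷ C ∷ []) ⊆ smalls
  increasing⇒⊆smalls A∈ B∈ C∈ A<B B<C C<k =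
    Unique-pair⊆-join (Strict⇒Unique smalls↑) (Strict-pair⊆ smalls↑ (∈-smalls⁺ A∈ (<-trans A<B B<k)) B∈s A<B)
                                              (Strict-pair⊆ smalls↑ B∈s (∈-smalls⁺ C∈ C<k) B<C)
    where
    smalls↑ = range-strict (k ∸ 1)
    B<k = <-trans B<C C<k
    B∈s = ∈-smalls⁺ B∈ B<k

  big⇒pos∉α : ∀ {b} → b ∈ ρ → k < b → pos b ρ ∉ αρ
  big⇒pos∉α b∈ρ k<b p∈α with ∈-map⁻ (λ v → pos v ρ) p∈α
  ... | v , v∈ , eq with pos-injective b∈ρ (smalls⇒ρ v∈) eq
  ...   | refl = <-asym k<b (proj₂ (∈-smalls⁻ v∈))

  ¬Occ31|2⇒avoids31|2 : ¬ Occ31|2 k ρ → Avoids31|2 αρ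
  ¬Occ31|2⇒avoids31|2 noOcc x y z sub y<z z<x (m , y≤m , m≤z , m∉α) with triple⊆-map⁻ (λ v → pos v ρ) smalls sub
  ... | a , b , c , abc , refl , refl , refl =
    noOcc (a , b , c , d , a<b , b<c , c<k , k<d , Unique-pair⊆-join uρ bd dc , pos-mono⁻ cρ aρ z<x)
    where
    smalls↑ = range-strict (k ∸ 1)
    a<b = AllPairs-pair⊆ smalls↑ (triple⊆⇒₁₂ abc)
    b<c = AllPairs-pair⊆ smalls↑ (triple⊆⇒₂₃ abc)
    c<k = proj₂ (∈-smalls⁻ (to∈ (Sublist.∷ˡ⁻ (triple⊆⇒₂₃ abc))))
    aρ = smalls⇒ρ (to∈ abc)
    bρ = smalls⇒ρ (to∈ (triple⊆⇒₂₃ abc))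
    cρ = smalls⇒ρ (to∈ (Sublist.∷ˡ⁻ (triple⊆⇒₂₃ abc)))
    b<m : pos b ρ < m
    b<m = ≤∧≢⇒< y≤m (λ eq → m∉α (subst (_∈ αρ) eq (∈-map⁺ _ (to∈ (triple⊆⇒₂₃ abc)))))
    found = pos-surjective ρ uρ m (≤-<-trans z≤n b<m) (≤-trans m≤z (pos-≤-length cρ))
    d = proj₁ found
    dρ = proj₁ (proj₂ found)
    pos-d = proj₂ (proj₂ found)
    k<d : k < d
    k<d with <-cmp d k
    ... | tri< d<k _ _ = ⊥-elim (m∉α (subst (_∈ αρ) pos-d (∈-map⁺ _ (∈-smalls⁺ dρ d<k))))
    ... | tri≈ _ d≡k _ = ⊥-elim (ρ≢k dρ d≡k)
    ... | tri> _ _ k<d = k<d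
    bd = pos-mono⁻ bρ dρ (subst (pos b ρ <_) (sym pos-d) b<m)
    dc = pos-mono⁻ dρ cρ (≤∧≢⇒< (subst (_≤ pos c ρ) (sym pos-d) m≤z)
           (λ eq → <-asym c<k (subst (k <_) (pos-injective dρ cρ eq) k<d)))

  avoids31|2⇒¬Occ31|2 : Avoids31|2 αρ → ¬ Occ31|2 k ρ
  avoids31|2⇒¬Occ31|2 avoids (A , B , C , b , A<B , B<C , C<k , k<b , BbC , CA) =
    avoids (pos A ρ) (pos B ρ) (pos C ρ) (Sublist.map⁺ _ (increasing⇒⊆smalls Aρ Bρ Cρ A<B B<C C<k))
      (pos-mono (triple⊆⇒₁₃ BbC)) (pos-mono CA)
      (pos b ρ , <⇒≤ (pos-mono (triple⊆⇒₁₂ BbC)) , <⇒≤ (pos-mono (triple⊆⇒₂₃ BbC)) ,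
       big⇒pos∉α (to∈ (triple⊆⇒₂₃ BbC)) k<b)
    where
    Aρ = to∈ (Sublist.∷ˡ⁻ CA)
    Bρ = to∈ BbC
    Cρ = to∈ CA

  ¬Occb21b3⇒avoids-b21b3 : ¬ Occb21b3 k ρ → Avoids-b21b3 αρ
  ¬Occb21b3⇒avoids-b21b3 noOcc x y z sub y<x x<z x≡z∸1 with triple⊆-map⁻ (λ v → pos v ρ) smalls sub
  ... | a , b , c , abc , refl , refl , refl with pos-adjacent aρ cρ (pred-eq x≡z∸1 x<z)
    where
    aρ = smalls⇒ρ (to∈ abc)
    cρ = smalls⇒ρ (to∈ (Sublist.∷ˡ⁻ (triple⊆⇒₂₃ abc)))
    pred-eq : ∀ {m n} → m ≡ n ∸ 1 → m < n → n ≡ suc m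
    pred-eq {n = suc n} refl _ = refl
  ...   | P , Q , eq = noOcc (a , b , c , P , Q , eq , pos-before eq (smalls⇒ρ (to∈ (triple⊆⇒₂₃ abc))) y<x ,
            AllPairs-pair⊆ smalls↑ (triple⊆⇒₁₂ abc) , AllPairs-pair⊆ smalls↑ (triple⊆⇒₂₃ abc) ,
            proj₂ (∈-smalls⁻ (to∈ (Sublist.∷ˡ⁻ (triple⊆⇒₂₃ abc)))))
    where smalls↑ = range-strict (k ∸ 1)

  avoids-b21b3⇒¬Occb21b3 : Avoids-b21b3 αρ → ¬ Occb21b3 k ρ
  avoids-b21b3⇒¬Occb21b3 avoids (A , B , C , D , R , eq , B∈D , A<B , B<C , C<k) =
    avoids (pos A ρ) (pos B ρ) (pos C ρ) (Sublist.map⁺ _ (increasing⇒⊆smalls Aρ Bρ Cρ A<B B<C C<k))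
      (pos-mono (subst (_ ⊆_) (sym eq) (pair⊆-++⁺ B∈D (here refl))))
      (pos-mono (subst (_ ⊆_) (sym eq) (Sublist.++⁺ˡ D (refl ∷ refl ∷ minimum R))))
      (trans (pos-split eq) (sym (cong (_∸ 1) (trans (pos-split eqC) (cong suc (trans (length-++ D) (+-comm (length D) 1)))))))
    where
    Aρ = subst (A ∈_) (sym eq) (∈-++⁺ʳ D (here refl))
    Bρ = subst (B ∈_) (sym eq) (∈-++⁺ˡ B∈D)
    Cρ = subst (C ∈_) (sym eq) (∈-++⁺ʳ D (there (here refl)))
    eqC : ρ ≡ (D ++ [ A ]) ++ C ∷ R
    eqC = trans eq (sym (++-assoc D [ A ] (C ∷ R)))

  α≡αρ : α (k ∷ ρ) ≡ αρ
  α≡αρ = map-cong-local (All.tabulate λ v∈ →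
    cong (_∸ 1) (pos-tail ρ (λ v≡k → <-irrefl v≡k (proj₂ (∈-smalls⁻ v∈)))))

  avoids31|2⇔¬Occ31|2 : Avoids31|2 αρ ⇔ (¬ Occ31|2 k ρ)
  avoids31|2⇔¬Occ31|2 = mk⇔ avoids31|2⇒¬Occ31|2 ¬Occ31|2⇒avoids31|2

  avoids-b21b3⇔¬Occb21b3 : Avoids-b21b3 αρ ⇔ (¬ Occb21b3 k ρ)
  avoids-b21b3⇔¬Occb21b3 = mk⇔ avoids-b21b3⇒¬Occb21b3 ¬Occb21b3⇒avoids-b21b3

mainTheorem13 : (n : ℕ) (π : List ℕ) → IsPerm n π → Avoids[132 π →
    (Sortable T123-312 n π ⇔ (Avoids31|2 (α π) × Avoids-b21b3 (α π)))
mainTheorem13 n [] perm _ = mk⇔ (λ _ → (λ _ _ _ ()) , (λ _ _ _ ())) (λ _ → sym (↭-empty-inv (↭-sym perm)))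
mainTheorem13 n (k ∷ ρ) perm av = begin
  Sortable T123-312 n (k ∷ ρ)                           ∼⟨ sortable⇔avoids231 n perm ⟩
  Avoids231 F                                           ∼⟨ avoids231⇔¬Occ ⟩
  (¬ Occ31|2 k ρ × ¬ Occb21b3 k ρ)                      ∼⟨ ⇔-sym (avoids31|2⇔¬Occ31|2 ×-⇔ avoids-b21b3⇔¬Occb21b3) ⟩
  (Avoids31|2 αρ × Avoids-b21b3 αρ)                     ≡⟨ cong (λ a → Avoids31|2 a × Avoids-b21b3 a) (sym α≡αρ) ⟩
  (Avoids31|2 (α (k ∷ ρ)) × Avoids-b21b3 (α (k ∷ ρ)))   ∎
  where
  open Related.EquationalReasoning
  open Run123-312 k ρ (Unique-resp-↭ (↭-sym perm) (Strict⇒Unique (range-strict n))) av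
  open Alpha k ρ uρ ρ≢k (perm⇒positive perm) (perm⇒small∈ρ perm)
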